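{- Let $q$ be a prime power, $n$ a positive integer coprime to $q$, and $I\subseteq\{1,\ldots,m\}$. Then the map $\varphi_I:\mathcal{Q}_I\to\mathcal{E}_I$ is a bijection.
   Context: Let $\mathcal{Q}=\mathbb{F}_q[X]/(X^n-1)$. Consider the equivalence relation on $\mathbb{Z}_n$ generated by $z\sim qz$; let integers $s_1,\ldots,s_m$ represent its $m$ classes, the class of $s_i$ being $S_i=\{s_i,qs_i,\ldots,q^{\ell_i-1}s_i\}$ with $\ell_i$ the smallest positive integer such that $q^{\ell_i}s_i\equiv s_i\pmod n$. Fix a primitive $n$-th root of unity $\omega$ in an algebraic closure of $\mathbb{F}_q$ and let $P_i=\prod_{k\in S_i}(X-\omega^k)\in\mathbb{F}_q[X]$, viewed in $\mathcal{Q}$. Let $G_i$ be the multiplicative group of the field $\mathcal{Q}/P_i\mathcal{Q}$ (cyclic of order $q^{\ell_i}-1$), $\alpha_i$ the image of $\alpha$ in $\mathcal{Q}/P_i\mathcal{Q}$, $X_i$ the image of $X$. Let $D_i=\frac{(q^{\ell_i}-1)\gcd(n,s_i)}{n}$ and fix a generator $g_i$ of $G_i$ with $X_i=g_i^{D_i}$. For $\alpha$ not divisible by $P_i$, $\log_{g_i}(\alpha)$ is the least $k\ge0$ with $\alpha_i=g_i^k$, and $a_i(\alpha),b_i(\alpha)$ are the quotient and remainder of $\log_{g_i}(\alpha)$ divided by $D_i$. For each $I\subseteq\{1,\ldots,m\}$ fix a group automorphism $\phi_I$ of $\prod_{i\in I}\mathbb{Z}_{n/\gcd(n,s_i)}$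 such that $\sum_{i\in I}s_ih_{i,I}\equiv\gcd(n,\gcd(s_i)_{i\in I})\pmod n$, where $h_{i,I}$ is the $i$-th coordinate of $\phi_I(1,\ldots,1)$ (such $\phi_I$ exists). Let $\mathcal{Q}_I=\{\alpha\in\mathcal{Q}: P_i\mid\alpha \text{ iff } i\notin I\}$. Let $\mathcal{E}$ be the set of all functions $\mathbb{Z}_n\to\{0,\ldots,q-1\}$, $L_{q-1}(f)=\{z: f(z)=q-1\}$, and $\mathcal{E}_I=\{f\in\mathcal{E}: S_i\subseteq L_{q-1}(f)\text{ iff } i\notin I\}$. For $\alpha\in\mathcal{Q}_I$ and $i\in I$ let $\phi_{i,I}(\alpha)\in\{0,\ldots,\frac{n}{\gcd(n,s_i)}-1\}$ be the $i$-th coordinate of $\phi_I\big((a_i(\alpha)\bmod \tfrac{n}{\gcd(n,s_i)})_{i\in I}\big)$, and let $c_{i,0},\ldots,c_{i,\ell_i-1}\in\{0,\ldots,q-1\}$ be the base-$q$ digits with $\sum_{j=0}^{\ell_i-1}c_{i,j}q^j=b_i(\alpha)\frac{n}{\gcd(n,s_i)}+\phi_{i,I}(\alpha)$ (this number lies in $\{0,\ldots,q^{\ell_i}-2\}$). Define $\varphi_I(\alpha)=f_\alpha$ by $f_\alpha(q^js_i)=q-1$ if $i\notin I$ and $f_\alpha(q^js_i)=c_{i,j}$ if $i\in I$ ($0\le j<\ell_i$). -}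

module Defs where

open import Level using (0ℓ)
open import Data.Nat using (ℕ; zero; suc; _+_; _*_; _∸_; _^_; _<_; _≡ᵇ_; NonZero)
open import Data.Nat.DivMod using (_/_; _%_; _mod_)
open import Data.Nat.GCD using (gcd)
open import Data.Nat.Coprimality using (Coprime)
open import Data.Nat.Primality using (Prime)
open import Data.Bool using (Bool; true; false; if_then_else_)
open import Data.Fin using (Fin; toℕ)
open import Data.Fin.Subset using (Subset; _∈_; _∉_)
open import Data.List using (List; []; _∷_; map; foldr; upTo; allFin)
open import Data.Nat.ListAction using (sum)
open import Data.Vec using (lookup)
open import Data.Vec.Functional using (toList)
open import Data.Product using (Σ; ∃; _×_)
open import Relation.Nullary using (¬_)
open import Relation.Binary.PropositionalEquality using (_≡_; _≢_)
open import Algebra.Structures using (IsCommutativeRing)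
open import Function.Bundles using (_↔_)

-- Total division / remainder on ℕ (divisor 0 gives junk; never used
-- with divisor 0 in the statement, all divisors there are positive).

div' : ℕ → ℕ → ℕ
div' k zero    = zero
div' k (suc d) = k / suc d

mod' : ℕ → ℕ → ℕ
mod' k zero    = k
mod' k (suc d) = k % suc d

IsPrimePower : ℕ → Set
IsPrimePower q = Σ ℕ λ p → Σ ℕ λ k → Prime p × (0 < k) × (q ≡ p ^ k)

record Field : Set₁ where
  infixl 6 _+ᶠ_
  infixl 7 _*ᶠ_
  field
    Carrier : Set
    _+ᶠ_ _*ᶠ_ : Carrier → Carrier → Carrier
    -ᶠ_     : Carrier → Carrier
    0# 1#   : Carrier
    isCommutativeRing : IsCommutativeRing _≡_ _+ᶠ_ _*ᶠ_ -ᶠ_ 0# 1#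
    0≢1     : 0# ≢ 1#
    inverse : ∀ x → x ≢ 0# → ∃ λ y → x *ᶠ y ≡ 1#

  pow : Carrier → ℕ → Carrier
  pow x zero    = 1#
  pow x (suc k) = x *ᶠ pow x k

record FiniteField (q : ℕ) : Set₁ where
  field
    field′ : Field
  open Field field′ public
  field
    enumeration : Carrier ↔ Fin q

record IsFieldHom (F K : Field) (ι : Field.Carrier F → Field.Carrier K) : Set where
  private
    module F = Field F
    module K = Field K
  field
    pres-1 : ι F.1# ≡ K.1#
    pres-+ : ∀ x y → ι (x F.+ᶠ y) ≡ ι x K.+ᶠ ι y
    pres-* : ∀ x y → ι (x F.*ᶠ y) ≡ ι x K.*ᶠ ι y

-- Polynomials over a field as coefficient lists (constant term first).

module Poly (F : Field) where
  open Field F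

  addP : List Carrier → List Carrier → List Carrier
  addP []       ys       = ys
  addP (x ∷ xs) []       = x ∷ xs
  addP (x ∷ xs) (y ∷ ys) = (x +ᶠ y) ∷ addP xs ys

  mulP : List Carrier → List Carrier → List Carrier
  mulP []       ys = []
  mulP (x ∷ xs) ys = addP (map (x *ᶠ_) ys) (0# ∷ mulP xs ys)

redℕ : (n : ℕ) → NonZero n → ℕ → Fin n
redℕ n nz k = _mod_ k n {{nz}}

data Gen (q n : ℕ) (nz : NonZero n) : Fin n → Fin n → Set where
  step  : ∀ z → Gen q n nz z (redℕ n nz (q * toℕ z))
  refl′ : ∀ z → Gen q n nz z z
  sym′  : ∀ {z w} → Gen q n nz z w → Gen q n nz w z
  trans′ : ∀ {z w v} → Gen q n nz z w → Gen q n nz w v → Gen q n nz z v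

record Base : Set₁ where
  field
    q          : ℕ
    q-pp       : IsPrimePower q
    𝔽          : FiniteField q
    n          : ℕ
    nz         : NonZero n
    coprime    : Coprime n q
    m          : ℕ
    s          : Fin m → Fin n
    s-cover    : ∀ z → Σ (Fin m) λ i → Gen q n nz z (s i)
    s-distinct : ∀ i j → Gen q n nz (s i) (s j) → i ≡ j
    ℓ          : Fin m → ℕ
    ℓ-pos      : ∀ i → 0 < ℓ i
    ℓ-period   : ∀ i → redℕ n nz (q ^ ℓ i * toℕ (s i)) ≡ s i
    ℓ-least    : ∀ i j → 0 < j → j < ℓ i → redℕ n nz (q ^ j * toℕ (s i)) ≢ s i
    K          : Field
    ι          : FiniteField.Carrier 𝔽 → Field.Carrier K
    ι-hom      : IsFieldHom (FiniteField.field′ 𝔽) K ι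
    ω          : Field.Carrier K
    ω-root     : Field.pow K ω n ≡ Field.1# K
    ω-primitive : ∀ k → 0 < k → k < n → Field.pow K ω k ≢ Field.1# K

module BaseDefs (B : Base) where
  open Base B public
  module 𝔽 = FiniteField 𝔽
  module KK = Field K
  F = 𝔽.Carrier

  red : ℕ → Fin n
  red = redℕ n nz

  pt : Fin m → ℕ → Fin n
  pt i j = red (q ^ j * toℕ (s i))

  InS : Fin m → Fin n → Set
  InS i z = Σ ℕ λ j → j < ℓ i × z ≡ pt i j

  prodK : Fin m → List KK.Carrier
  prodK i = foldr (Poly.mulP K) (KK.1# ∷ []) (map lin (upTo (ℓ i)))
    where
    lin : ℕ → List KK.Carrier
    lin j = (KK.-ᶠ KK.pow ω (toℕ (pt i j))) ∷ KK.1# ∷ []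

  -- 𝒬 = 𝔽_q[X]/(X^n - 1), elements = coefficient vectors of reduced
  -- representatives (degree < n).
  𝒬 : Set
  𝒬 = Fin n → F

  -- reduce a polynomial modulo X^n - 1
  toQ : List F → 𝒬
  toQ []       = λ _ → 𝔽.0#
  toQ (c ∷ cs) = λ i → (if toℕ i ≡ᵇ 0 then c else 𝔽.0#) 𝔽.+ᶠ toQ cs (red (toℕ i + (n ∸ 1)))

  mulQ : 𝒬 → 𝒬 → 𝒬
  mulQ a b = toQ (Poly.mulP (FiniteField.field′ 𝔽) (toList a) (toList b))

  subQ : 𝒬 → 𝒬 → 𝒬
  subQ a b i = a i 𝔽.+ᶠ (𝔽.-ᶠ b i)

  powQ : 𝒬 → ℕ → 𝒬
  powQ g zero    = toQ (𝔽.1# ∷ [])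
  powQ g (suc k) = mulQ g (powQ g k)

  XQ : 𝒬
  XQ = toQ (𝔽.0# ∷ 𝔽.1# ∷ [])

  _≈Q_ : 𝒬 → 𝒬 → Set
  a ≈Q b = ∀ i → a i ≡ b i

  _∣Q_ : 𝒬 → 𝒬 → Set
  P ∣Q α = Σ 𝒬 λ β → mulQ P β ≈Q α

  -- congruence modulo P in 𝒬 (equality in 𝒬/P𝒬)
  Cong : 𝒬 → 𝒬 → 𝒬 → Set
  Cong P α β = P ∣Q subQ α β

  ni : Fin m → ℕ
  ni i = div' n (gcd n (toℕ (s i)))

  D : Fin m → ℕ
  D i = div' ((q ^ ℓ i ∸ 1) * gcd n (toℕ (s i))) n

record Setup : Set₁ where
  field
    base : Base
  open BaseDefs base
  field
    P       : Fin m → List F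
    P-def   : ∀ i → map ι (P i) ≡ prodK i
    g       : Fin m → 𝒬
    g-unit  : ∀ i → ¬ (toQ (P i) ∣Q g i)
    g-gen   : ∀ i α → ¬ (toQ (P i) ∣Q α) → Σ ℕ λ k → Cong (toQ (P i)) α (powQ (g i) k)
    g-X     : ∀ i → Cong (toQ (P i)) XQ (powQ (g i) (D i))

module SetupDefs (S : Setup) where
  open Setup S public
  open BaseDefs base public

  Pq : Fin m → 𝒬
  Pq i = toQ (P i)

  IsLog : Fin m → 𝒬 → ℕ → Set
  IsLog i α k = Cong (Pq i) α (powQ (g i) k) × (∀ j → j < k → ¬ Cong (Pq i) α (powQ (g i) j))

  InQ : Subset m → 𝒬 → Set
  InQ I α = ∀ i → ((Pq i ∣Q α) → i ∉ I) × (i ∉ I → Pq i ∣Q α)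

  ℰ : Set
  ℰ = Fin n → Fin q

  InE : Subset m → ℰ → Set
  InE I f = ∀ i → ((∀ z → InS i z → toℕ (f z) ≡ q ∸ 1) → i ∉ I)
                × (i ∉ I → ∀ z → InS i z → toℕ (f z) ≡ q ∸ 1)

  -- ∏_{i∈I} ℤ_{n/gcd(n,s_i)}: elements represented by functions Fin m → ℕ,
  -- only coordinates in I matter, each reduced (< n_i).
  Grp : Set
  Grp = Fin m → ℕ

  Valid : Subset m → Grp → Set
  Valid I x = ∀ i → i ∈ I → x i < ni i

  EqI : Subset m → Grp → Grp → Set
  EqI I x y = ∀ i → i ∈ I → x i ≡ y i

  addG : Grp → Grp → Grp
  addG x y i = mod' (x i + y i) (ni i)

  oneG : Grp
  oneG i = mod' 1 (ni i)

  IsAut : Subset m → (Grp → Grp) → Set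
  IsAut I φ =
      (∀ x → Valid I x → Valid I (φ x))
    × (∀ x y → Valid I x → Valid I y → EqI I x y → EqI I (φ x) (φ y))
    × (∀ x y → Valid I x → Valid I y → EqI I (φ (addG x y)) (addG (φ x) (φ y)))
    × (∀ x y → Valid I x → Valid I y → EqI I (φ x) (φ y) → EqI I x y)
    × (∀ y → Valid I y → Σ Grp λ x → Valid I x × EqI I (φ x) y)

  sumSH : Subset m → Grp → ℕ
  sumSH I h = sum (map (λ i → if lookup I i then toℕ (s i) * h i else 0) (allFin m))

  gcdI : Subset m → ℕ
  gcdI I = foldr (λ i acc → if lookup I i then gcd (toℕ (s i)) acc else acc) 0 (allFin m)

  GoodAut : Subset m → (Grp → Grp) → Set
  GoodAut I φ = IsAut I φ × (mod' (sumSH I (φ oneG)) n ≡ mod' (gcd n (gcdI I)) n)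

  -- "f = φ_I(α)", with ks the logarithms log_{g_i}(α) (i ∈ I)
  PhiVal : Subset m → (Grp → Grp) → Grp → Fin m → ℕ → ℕ
  PhiVal I φ ks i j = if lookup I i then mod' (div' N (q ^ j)) q else q ∸ 1
    where
    a : Grp
    a i′ = div' (ks i′) (D i′)
    b : ℕ
    b = mod' (ks i) (D i)
    φiI : ℕ
    φiI = φ (λ i′ → mod' (a i′) (ni i′)) i
    N : ℕ
    N = b * ni i + φiI

  IsPhi : Subset m → (Grp → Grp) → 𝒬 → ℰ → Set
  IsPhi I φ α f = Σ Grp λ ks → (∀ i → i ∈ I → IsLog i α (ks i))
                × (∀ i j → j < ℓ i → toℕ (f (pt i j)) ≡ PhiVal I φ ks i j)

  PhiBijective : Subset m → (Grp → Grp) → Set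
  PhiBijective I φ =
      (∀ α → InQ I α → Σ ℰ λ f → IsPhi I φ α f × InE I f)
    × (∀ α f f′ → InQ I α → IsPhi I φ α f → IsPhi I φ α f′ → ∀ z → f z ≡ f′ z)
    × (∀ α α′ f → InQ I α → InQ I α′ → IsPhi I φ α f → IsPhi I φ α′ f → α ≈Q α′)
    × (∀ f → InE I f → Σ 𝒬 λ α → InQ I α × IsPhi I φ α f)

module Submission where

-- Evaluate α ∈ 𝒬 = 𝔽_q[X]/(X^n − 1) at the n-th roots of unity ω^z.  This is
-- multiplicative, and since the ω^z are n distinct roots, α is determined by its values
-- (root bound).  P_i is monic of degree ℓ_i with the simple roots ω^z, z ∈ S_i, so
-- congruence modulo P_i means "equal values on S_i".  Hence discrete logarithms to base
-- g_i exist, are unique, and lie below q^ℓ_i − 1 = D_i·n_i (pigeonhole on remainders of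
-- powers of g_i).  On S_i, φ_I(α) writes the base-q digits of N_i = b_i n_i + φ_{i,I}(α)
-- < q^ℓ_i − 1, so S_i is never saturated for i ∈ I: φ_I(α) ∈ ℰ_I.  The digits give back
-- N_i, hence b_i and (φ_I being injective) a_i mod n_i, hence the logarithms and α:
-- φ_I is injective.  For surjectivity the digit maps of all 𝒬_J (with the identity in
-- place of φ_I for J ≠ I) glue to an injection 𝒬 → ℰ between sets of size q^n, which is
-- therefore onto; the index set J is read off the image.

open import Defs
open import Level using (0ℓ)
open import Algebra.Bundles using (CommutativeRing)
open import Relation.Binary.PropositionalEquality
open import Data.Nat as ℕ using (ℕ; zero; suc)
import Data.Nat.Properties as ℕP
open import Data.Product using (Σ; _×_; _,_; proj₁; proj₂)
open import Data.Fin as Fin using (Fin; toℕ; fromℕ; inject₁)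
import Data.Fin.Properties as FinP
open import Data.List using (List; []; _∷_; map; tabulate; length; _++_; replicate; foldr; upTo)
import Data.List.Properties as ListP
import Data.List.Relation.Unary.All.Properties as AllP
open import Data.Nat.DivMod using (_%_; _/_; [m+n]%n≡m%n; m<n⇒m%n≡m)
open import Data.List.Relation.Unary.All as All using (All; []; _∷_)
open import Data.Bool using (true; false; if_then_else_; not)
import Data.Vec
open import Data.Empty using (⊥-elim)
open import Relation.Nullary using (¬_; Dec; yes; no)
open import Relation.Nullary.Decidable using (⌊_⌋)
open import Data.Fin.Subset using (Subset; _∈_; _∉_)
open import Data.Fin.Subset.Properties using (_∈?_; ⊆-antisym)
import Data.Vec.Properties as VecP
open import Function using (id; _∘_)

module FieldFacts (F : Field) where
  open Field F public

  commutativeRing : CommutativeRing 0ℓ 0ℓ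
  commutativeRing = record { isCommutativeRing = isCommutativeRing }

  open CommutativeRing commutativeRing public
    using ( +-assoc; *-assoc; +-identityˡ; +-identityʳ; *-identityˡ; *-identityʳ
          ; -‿inverseˡ; -‿inverseʳ; zeroˡ; zeroʳ)
  open import Algebra.Properties.Ring (CommutativeRing.ring commutativeRing) public
    using (-‿involutive; -‿distribˡ-*; x[y-z]≈xy-xz; x∙y⁻¹≈ε⇒x≈y; x+x≈x⇒x≈0)
  open import Algebra.Solver.Ring.NaturalCoefficients.Default
    (CommutativeRing.commutativeSemiring commutativeRing) public
    using (solve; _:+_; _:*_; _:=_; con)

  infixl 6 _-ᶠ_
  _-ᶠ_ : Carrier → Carrier → Carrier
  x -ᶠ y = x +ᶠ (-ᶠ y)

  sub≡0 : ∀ x y → x -ᶠ y ≡ 0# → x ≡ y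
  sub≡0 = x∙y⁻¹≈ε⇒x≈y

  x+y≡z⇒x≡z-y : ∀ {x y z} → x +ᶠ y ≡ z → x ≡ z -ᶠ y
  x+y≡z⇒x≡z-y {x} {y} {z} x+y≡z = begin
      x                 ≡⟨ sym (+-identityʳ x) ⟩
      x +ᶠ 0#           ≡⟨ cong (x +ᶠ_) (sym (-‿inverseʳ y)) ⟩
      x +ᶠ (y -ᶠ y)     ≡⟨ sym (+-assoc x y (-ᶠ y)) ⟩
      (x +ᶠ y) -ᶠ y     ≡⟨ cong (_-ᶠ y) x+y≡z ⟩
      z -ᶠ y            ∎
    where open ≡-Reasoning

  nonzero-cancel : ∀ {x y} → x ≢ 0# → x *ᶠ y ≡ 0# → y ≡ 0#
  nonzero-cancel {x} {y} x≢0 xy≡0 with inverse x x≢0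
  ... | x⁻¹ , xx⁻¹≡1 = begin
      y                    ≡⟨ sym (*-identityˡ y) ⟩
      1# *ᶠ y              ≡⟨ cong (_*ᶠ y) (sym xx⁻¹≡1) ⟩
      (x *ᶠ x⁻¹) *ᶠ y      ≡⟨ solve 3 (λ x y z → (x :* z) :* y := z :* (x :* y)) refl x y x⁻¹ ⟩
      x⁻¹ *ᶠ (x *ᶠ y)      ≡⟨ cong (x⁻¹ *ᶠ_) xy≡0 ⟩
      x⁻¹ *ᶠ 0#            ≡⟨ zeroʳ x⁻¹ ⟩
      0#                   ∎
    where open ≡-Reasoning

  pow-+ : ∀ x a b → pow x (a ℕ.+ b) ≡ pow x a *ᶠ pow x b
  pow-+ x zero    b = sym (*-identityˡ _)
  pow-+ x (suc a) b = trans (cong (x *ᶠ_) (pow-+ x a b)) (sym (*-assoc x _ _))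

  pow-* : ∀ x a b → pow x (a ℕ.* b) ≡ pow (pow x a) b
  pow-* x a zero    = cong (pow x) (ℕP.*-zeroʳ a)
  pow-* x a (suc b) = trans (cong (pow x) (ℕP.*-suc a b))
                            (trans (pow-+ x a (a ℕ.* b)) (cong (pow x a *ᶠ_) (pow-* x a b)))

  pow-1# : ∀ k → pow 1# k ≡ 1#
  pow-1# zero    = refl
  pow-1# (suc k) = trans (*-identityˡ _) (pow-1# k)

  pow≢0 : ∀ {x} k → x ≢ 0# → pow x k ≢ 0#
  pow≢0 zero    x≢0 1≡0 = 0≢1 (sym 1≡0)
  pow≢0 (suc k) x≢0 e   = pow≢0 k x≢0 (nonzero-cancel x≢0 e)

  pow-cancel : ∀ {x} a d → x ≢ 0# → pow x a ≡ pow x (a ℕ.+ d) → pow x d ≡ 1#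
  pow-cancel {x} a d x≢0 e = sub≡0 _ _ (nonzero-cancel (pow≢0 a x≢0) (begin
      pow x a *ᶠ (pow x d -ᶠ 1#)                ≡⟨ x[y-z]≈xy-xz (pow x a) (pow x d) 1# ⟩
      pow x a *ᶠ pow x d -ᶠ pow x a *ᶠ 1#       ≡⟨ cong₂ _-ᶠ_ (sym (pow-+ x a d)) (*-identityʳ _) ⟩
      pow x (a ℕ.+ d) -ᶠ pow x a                ≡⟨ cong (_-ᶠ pow x a) (sym e) ⟩
      pow x a -ᶠ pow x a                        ≡⟨ -‿inverseʳ _ ⟩
      0#                                        ∎))
    where open ≡-Reasoning


module PolyEval (A B : Field) (h : Field.Carrier A → Field.Carrier B) (hom : IsFieldHom A B h) where
  module A = FieldFacts A
  module B = FieldFacts B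
  open IsFieldHom hom public
  open B using (_:+_; _:*_; _:=_; con)
  open Poly A

  pres-0 : h A.0# ≡ B.0#
  pres-0 = B.x+x≈x⇒x≈0 (h A.0#) (trans (sym (pres-+ A.0# A.0#)) (cong h (A.+-identityˡ A.0#)))

  pres-neg : ∀ x → h (A.-ᶠ x) ≡ B.-ᶠ h x
  pres-neg x = B.sub≡0 _ _ (begin
      h (A.-ᶠ x) B.-ᶠ B.-ᶠ h x   ≡⟨ cong (h (A.-ᶠ x) B.+ᶠ_) (B.-‿involutive (h x)) ⟩
      h (A.-ᶠ x) B.+ᶠ h x        ≡⟨ sym (pres-+ _ _) ⟩
      h (A.-ᶠ x A.+ᶠ x)          ≡⟨ cong h (A.-‿inverseˡ x) ⟩
      h A.0#                     ≡⟨ pres-0 ⟩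
      B.0#                       ∎)
    where open ≡-Reasoning

  pres-≢0 : ∀ {x} → x ≢ A.0# → h x ≢ B.0#
  pres-≢0 {x} x≢0 hx≡0 with A.inverse x x≢0
  ... | y , xy≡1 = B.0≢1 (begin
      B.0#             ≡⟨ sym (B.zeroˡ _) ⟩
      B.0# B.*ᶠ h y    ≡⟨ cong (B._*ᶠ h y) (sym hx≡0) ⟩
      h x B.*ᶠ h y     ≡⟨ sym (pres-* x y) ⟩
      h (x A.*ᶠ y)     ≡⟨ cong h xy≡1 ⟩
      h A.1#           ≡⟨ pres-1 ⟩
      B.1#             ∎)
    where open ≡-Reasoning

  -- … and is therefore injective (decidable equality on A makes this constructive)
  injective : (∀ (x y : A.Carrier) → Dec (x ≡ y)) → ∀ {x y} → h x ≡ h y → x ≡ y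
  injective _≟_ {x} {y} hx≡hy with (x A.-ᶠ y) ≟ A.0#
  ... | yes x-y≡0 = A.sub≡0 x y x-y≡0
  ... | no  x-y≢0 = ⊥-elim (pres-≢0 x-y≢0 (begin
      h (x A.-ᶠ y)         ≡⟨ pres-+ x (A.-ᶠ y) ⟩
      h x B.+ᶠ h (A.-ᶠ y)  ≡⟨ cong₂ B._+ᶠ_ hx≡hy (pres-neg y) ⟩
      h y B.-ᶠ h y         ≡⟨ B.-‿inverseʳ _ ⟩
      B.0#                 ∎))
    where open ≡-Reasoning

  eval : List A.Carrier → B.Carrier → B.Carrier
  eval []       x = B.0#
  eval (c ∷ cs) x = h c B.+ᶠ x B.*ᶠ eval cs x

  eval-add : ∀ a b x → eval (addP a b) x ≡ eval a x B.+ᶠ eval b x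
  eval-add []      b       x = sym (B.+-identityˡ _)
  eval-add (c ∷ a) []      x = sym (B.+-identityʳ _)
  eval-add (c ∷ a) (d ∷ b) x = begin
      h (c A.+ᶠ d) B.+ᶠ x B.*ᶠ eval (addP a b) x
        ≡⟨ cong₂ (λ u v → u B.+ᶠ x B.*ᶠ v) (pres-+ c d) (eval-add a b x) ⟩
      (h c B.+ᶠ h d) B.+ᶠ x B.*ᶠ (eval a x B.+ᶠ eval b x)
        ≡⟨ B.solve 5 (λ u v x p q → (u :+ v) :+ x :* (p :+ q) := (u :+ x :* p) :+ (v :+ x :* q))
                     refl (h c) (h d) x (eval a x) (eval b x) ⟩
      (h c B.+ᶠ x B.*ᶠ eval a x) B.+ᶠ (h d B.+ᶠ x B.*ᶠ eval b x) ∎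
    where open ≡-Reasoning

  eval-scale : ∀ c b x → eval (map (c A.*ᶠ_) b) x ≡ h c B.*ᶠ eval b x
  eval-scale c []      x = sym (B.zeroʳ _)
  eval-scale c (d ∷ b) x = begin
      h (c A.*ᶠ d) B.+ᶠ x B.*ᶠ eval (map (c A.*ᶠ_) b) x
        ≡⟨ cong₂ (λ u v → u B.+ᶠ x B.*ᶠ v) (pres-* c d) (eval-scale c b x) ⟩
      h c B.*ᶠ h d B.+ᶠ x B.*ᶠ (h c B.*ᶠ eval b x)
        ≡⟨ B.solve 4 (λ u v x p → u :* v :+ x :* (u :* p) := u :* (v :+ x :* p)) refl (h c) (h d) x (eval b x) ⟩
      h c B.*ᶠ (h d B.+ᶠ x B.*ᶠ eval b x) ∎
    where open ≡-Reasoning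

  eval-mul : ∀ a b x → eval (mulP a b) x ≡ eval a x B.*ᶠ eval b x
  eval-mul []      b x = sym (B.zeroˡ _)
  eval-mul (c ∷ a) b x = begin
      eval (addP (map (c A.*ᶠ_) b) (A.0# ∷ mulP a b)) x
        ≡⟨ eval-add (map (c A.*ᶠ_) b) (A.0# ∷ mulP a b) x ⟩
      eval (map (c A.*ᶠ_) b) x B.+ᶠ (h A.0# B.+ᶠ x B.*ᶠ eval (mulP a b) x)
        ≡⟨ cong₂ (λ u v → u B.+ᶠ (v B.+ᶠ x B.*ᶠ eval (mulP a b) x)) (eval-scale c b x) pres-0 ⟩
      h c B.*ᶠ eval b x B.+ᶠ (B.0# B.+ᶠ x B.*ᶠ eval (mulP a b) x)
        ≡⟨ cong (λ w → h c B.*ᶠ eval b x B.+ᶠ (B.0# B.+ᶠ x B.*ᶠ w)) (eval-mul a b x) ⟩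
      h c B.*ᶠ eval b x B.+ᶠ (B.0# B.+ᶠ x B.*ᶠ (eval a x B.*ᶠ eval b x))
        ≡⟨ B.solve 4 (λ u v x p → u :* v :+ (con 0 :+ x :* (p :* v)) := (u :+ x :* p) :* v)
                     refl (h c) (eval b x) x (eval a x) ⟩
      (h c B.+ᶠ x B.*ᶠ eval a x) B.*ᶠ eval b x ∎
    where open ≡-Reasoning

  eval-snoc : ∀ xs d x → eval (xs ++ d ∷ []) x ≡ eval xs x B.+ᶠ h d B.*ᶠ B.pow x (length xs)
  eval-snoc []       d x = B.solve 2 (λ d x → d :+ x :* con 0 := con 0 :+ d :* con 1) refl (h d) x
  eval-snoc (c ∷ xs) d x = trans (cong (λ t → h c B.+ᶠ x B.*ᶠ t) (eval-snoc xs d x))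
     (B.solve 5 (λ c x e d p → c :+ x :* (e :+ d :* p) := (c :+ x :* e) :+ d :* (x :* p))
                refl (h c) x (eval xs x) (h d) (B.pow x (length xs)))

  eval-zeros : ∀ xs x → All (_≡ A.0#) xs → eval xs x ≡ B.0#
  eval-zeros []       x []           = refl
  eval-zeros (c ∷ cs) x (c≡0 ∷ cs≡0) = begin
      h c B.+ᶠ x B.*ᶠ eval cs x   ≡⟨ cong₂ (λ a b → a B.+ᶠ x B.*ᶠ b) (trans (cong h c≡0) pres-0) (eval-zeros cs x cs≡0) ⟩
      B.0# B.+ᶠ x B.*ᶠ B.0#       ≡⟨ B.solve 1 (λ x → con 0 :+ x :* con 0 := con 0) refl x ⟩
      B.0#                        ∎
    where open ≡-Reasoning

  evalV : ∀ {N} → B.Carrier → (Fin N → A.Carrier) → B.Carrier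
  evalV x w = eval (tabulate w) x

  evalV-cong : ∀ {N} x {u v : Fin N → A.Carrier} → (∀ i → u i ≡ v i) → evalV x u ≡ evalV x v
  evalV-cong x u≗v = cong (λ l → eval l x) (ListP.tabulate-cong u≗v)

  evalV-0 : ∀ {N} x → evalV {N} x (λ _ → A.0#) ≡ B.0#
  evalV-0 {N} x = eval-zeros (tabulate {n = N} (λ _ → A.0#)) x (AllP.tabulate⁺ (λ _ → refl))

  evalV-+ : ∀ {N} x (u v : Fin N → A.Carrier) → evalV x (λ i → u i A.+ᶠ v i) ≡ evalV x u B.+ᶠ evalV x v
  evalV-+ {zero}  x u v = sym (B.+-identityˡ _)
  evalV-+ {suc N} x u v = begin
      h (u₀ A.+ᶠ v₀) B.+ᶠ x B.*ᶠ evalV x (λ i → u (Fin.suc i) A.+ᶠ v (Fin.suc i))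
        ≡⟨ cong₂ (λ a b → a B.+ᶠ x B.*ᶠ b) (pres-+ _ _) (evalV-+ x (λ i → u (Fin.suc i)) (λ i → v (Fin.suc i))) ⟩
      (h u₀ B.+ᶠ h v₀) B.+ᶠ x B.*ᶠ (evalV x (λ i → u (Fin.suc i)) B.+ᶠ evalV x (λ i → v (Fin.suc i)))
        ≡⟨ B.solve 5 (λ a b x c d → (a :+ b) :+ x :* (c :+ d) := (a :+ x :* c) :+ (b :+ x :* d)) refl _ _ x _ _ ⟩
      evalV x u B.+ᶠ evalV x v ∎
    where open ≡-Reasoning
          u₀ = u Fin.zero
          v₀ = v Fin.zero

  evalV-neg : ∀ {N} x (u : Fin N → A.Carrier) → evalV x (λ i → A.-ᶠ u i) ≡ B.-ᶠ evalV x u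
  evalV-neg {N} x u = B.sub≡0 _ _ (begin
      evalV x (λ i → A.-ᶠ u i) B.-ᶠ B.-ᶠ evalV x u ≡⟨ cong (evalV x (λ i → A.-ᶠ u i) B.+ᶠ_) (B.-‿involutive _) ⟩
      evalV x (λ i → A.-ᶠ u i) B.+ᶠ evalV x u       ≡⟨ sym (evalV-+ x (λ i → A.-ᶠ u i) u) ⟩
      evalV x (λ i → A.-ᶠ u i A.+ᶠ u i)             ≡⟨ evalV-cong x (λ i → A.-‿inverseˡ (u i)) ⟩
      evalV {N} x (λ _ → A.0#)                      ≡⟨ evalV-0 {N} x ⟩
      B.0#                                          ∎)
    where open ≡-Reasoning

  evalV-δ : ∀ {N} x c → evalV {suc N} x (λ i → if toℕ i ℕ.≡ᵇ 0 then c else A.0#) ≡ h c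
  evalV-δ {N} x c = begin
      h c B.+ᶠ x B.*ᶠ evalV {N} x (λ _ → A.0#) ≡⟨ cong (λ b → h c B.+ᶠ x B.*ᶠ b) (evalV-0 {N} x) ⟩
      h c B.+ᶠ x B.*ᶠ B.0#                     ≡⟨ B.solve 2 (λ c x → c :+ x :* con 0 := c) refl (h c) x ⟩
      h c                                      ∎
    where open ≡-Reasoning

  evalV-last : ∀ N x (w : Fin (suc N) → A.Carrier) →
               evalV x w ≡ evalV {N} x (λ i → w (inject₁ i)) B.+ᶠ h (w (fromℕ N)) B.*ᶠ B.pow x N
  evalV-last zero    x w = B.solve 2 (λ c x → c :+ x :* con 0 := con 0 :+ c :* con 1) refl (h (w Fin.zero)) x
  evalV-last (suc N) x w = begin
      h (w Fin.zero) B.+ᶠ x B.*ᶠ evalV x (λ i → w (Fin.suc i))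
        ≡⟨ cong (λ b → h (w Fin.zero) B.+ᶠ x B.*ᶠ b) (evalV-last N x (λ i → w (Fin.suc i))) ⟩
      h (w Fin.zero) B.+ᶠ x B.*ᶠ (evalV x (λ i → w (Fin.suc (inject₁ i))) B.+ᶠ h (w (fromℕ (suc N))) B.*ᶠ B.pow x N)
        ≡⟨ B.solve 5 (λ a x b c p → a :+ x :* (b :+ c :* p) := (a :+ x :* b) :+ c :* (x :* p))
                     refl (h (w Fin.zero)) x (evalV x (λ i → w (Fin.suc (inject₁ i)))) (h (w (fromℕ (suc N)))) (B.pow x N) ⟩
      (h (w Fin.zero) B.+ᶠ x B.*ᶠ evalV x (λ i → w (Fin.suc (inject₁ i)))) B.+ᶠ h (w (fromℕ (suc N))) B.*ᶠ (x B.*ᶠ B.pow x N) ∎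
    where open ≡-Reasoning

  -- At a point x with x^N = 1, cyclically shifting the coefficients up by one
  -- (w_{i-1 mod N} at position i) multiplies the value by x: this is X·w modulo X^N − 1.
  evalV-rotate : ∀ N (nzN : ℕ.NonZero N) x → B.pow x N ≡ B.1# → (w : Fin N → A.Carrier) →
                 evalV {N} x (λ i → w (redℕ N nzN (toℕ i ℕ.+ (N ℕ.∸ 1)))) ≡ x B.*ᶠ evalV x w
  evalV-rotate (suc M) nzN x xᴺ≡1 w = begin
      h (w (redℕ (suc M) nzN M)) B.+ᶠ x B.*ᶠ evalV {M} x (λ i → w (redℕ (suc M) nzN (suc (toℕ i ℕ.+ M))))
        ≡⟨ cong₂ (λ a b → h (w a) B.+ᶠ x B.*ᶠ b) red-top (evalV-cong x (λ i → cong w (red-shift i))) ⟩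
      h (w (fromℕ M)) B.+ᶠ x B.*ᶠ evalV {M} x (λ i → w (inject₁ i))
        ≡⟨ cong (B._+ᶠ x B.*ᶠ evalV {M} x (λ i → w (inject₁ i))) (sym (B.*-identityʳ _)) ⟩
      h (w (fromℕ M)) B.*ᶠ B.1# B.+ᶠ x B.*ᶠ evalV {M} x (λ i → w (inject₁ i))
        ≡⟨ cong (λ t → h (w (fromℕ M)) B.*ᶠ t B.+ᶠ x B.*ᶠ evalV {M} x (λ i → w (inject₁ i))) (sym xᴺ≡1) ⟩
      h (w (fromℕ M)) B.*ᶠ (x B.*ᶠ B.pow x M) B.+ᶠ x B.*ᶠ evalV {M} x (λ i → w (inject₁ i))
        ≡⟨ B.solve 4 (λ c x p b → c :* (x :* p) :+ x :* b := x :* (b :+ c :* p)) refl _ x _ _ ⟩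
      x B.*ᶠ (evalV {M} x (λ i → w (inject₁ i)) B.+ᶠ h (w (fromℕ M)) B.*ᶠ B.pow x M)
        ≡⟨ cong (x B.*ᶠ_) (sym (evalV-last M x w)) ⟩
      x B.*ᶠ evalV x w ∎
    where
    open ≡-Reasoning
    red-top : redℕ (suc M) nzN M ≡ fromℕ M
    red-top = FinP.toℕ-injective (trans (FinP.toℕ-fromℕ< _)
                (trans (m<n⇒m%n≡m (ℕP.n<1+n M)) (sym (FinP.toℕ-fromℕ M))))
    red-shift : ∀ (i : Fin M) → redℕ (suc M) nzN (suc (toℕ i ℕ.+ M)) ≡ inject₁ i
    red-shift i = FinP.toℕ-injective (begin
      toℕ (redℕ (suc M) nzN (suc (toℕ i ℕ.+ M))) ≡⟨ FinP.toℕ-fromℕ< _ ⟩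
      (suc (toℕ i ℕ.+ M)) % suc M   ≡⟨ cong (_% suc M) (sym (ℕP.+-suc (toℕ i) M)) ⟩
      (toℕ i ℕ.+ suc M) % suc M     ≡⟨ [m+n]%n≡m%n (toℕ i) (suc M) ⟩
      toℕ i % suc M                 ≡⟨ m<n⇒m%n≡m (ℕP.<-trans (FinP.toℕ<n i) (ℕP.n<1+n M)) ⟩
      toℕ i                         ≡⟨ sym (FinP.toℕ-inject₁ i) ⟩
      toℕ (inject₁ i)               ∎)


idHom : (B : Field) → IsFieldHom B B id
idHom B = record { pres-1 = refl ; pres-+ = λ _ _ → refl ; pres-* = λ _ _ → refl }

eval-map : (A B : Field) (h : Field.Carrier A → Field.Carrier B) (hom : IsFieldHom A B h) →
           ∀ p x → PolyEval.eval A B h hom p x ≡ PolyEval.eval B B id (idHom B) (map h p) x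
eval-map A B h hom []      x = refl
eval-map A B h hom (c ∷ p) x = cong (λ t → h c B.+ᶠ x B.*ᶠ t) (eval-map A B h hom p x)
  where module B = Field B

-- Root bound: a polynomial with at most r coefficients vanishing at r distinct
-- points is zero.  Proved by synthetic division by X − a.
module RootBound (B : Field) where
  open PolyEval B B id (idHom B) public using (eval)
  module B = FieldFacts B
  open B using (_:+_; _:*_; _:=_; con)

  AllZero : List B.Carrier → Set
  AllZero = All (_≡ B.0#)

  -- quotient of p by X − a
  divLinear : B.Carrier → List B.Carrier → List B.Carrier
  divLinear a []                 = []
  divLinear a (c ∷ [])           = []
  divLinear a (c ∷ cs@(_ ∷ _))   = eval cs a ∷ divLinear a cs

  divLinear-length : ∀ a p → length (divLinear a p) ≡ length p ℕ.∸ 1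
  divLinear-length a []           = refl
  divLinear-length a (c ∷ [])     = refl
  divLinear-length a (c ∷ d ∷ ds) = cong suc (divLinear-length a (d ∷ ds))

  divLinear-eval : ∀ a p y → eval p y ≡ (y B.-ᶠ a) B.*ᶠ eval (divLinear a p) y B.+ᶠ eval p a
  divLinear-eval a []       y = B.solve 2 (λ t y → con 0 := t :* con 0 :+ con 0) refl (y B.-ᶠ a) y
  divLinear-eval a (c ∷ []) y = B.solve 4 (λ c y a t → c :+ y :* con 0 := t :* con 0 :+ (c :+ a :* con 0)) refl c y a (y B.-ᶠ a)
  divLinear-eval a (c ∷ cs@(_ ∷ _)) y = begin
      c B.+ᶠ y B.*ᶠ eval cs y                               ≡⟨ cong (λ t → c B.+ᶠ y B.*ᶠ t) (divLinear-eval a cs y) ⟩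
      c B.+ᶠ y B.*ᶠ (t B.*ᶠ Q B.+ᶠ s)                       ≡⟨ cong (λ u → c B.+ᶠ u B.*ᶠ (t B.*ᶠ Q B.+ᶠ s)) y≡t+a ⟩
      c B.+ᶠ (t B.+ᶠ a) B.*ᶠ (t B.*ᶠ Q B.+ᶠ s)              ≡⟨ B.solve 5 (λ c t a Q s → c :+ (t :+ a) :* (t :* Q :+ s)
                                                                           := t :* (s :+ (t :+ a) :* Q) :+ (c :+ a :* s)) refl c t a Q s ⟩
      t B.*ᶠ (s B.+ᶠ (t B.+ᶠ a) B.*ᶠ Q) B.+ᶠ (c B.+ᶠ a B.*ᶠ s) ≡⟨ cong (λ u → t B.*ᶠ (s B.+ᶠ u B.*ᶠ Q) B.+ᶠ (c B.+ᶠ a B.*ᶠ s)) (sym y≡t+a) ⟩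
      t B.*ᶠ (s B.+ᶠ y B.*ᶠ Q) B.+ᶠ (c B.+ᶠ a B.*ᶠ s)         ∎
    where
    open ≡-Reasoning
    t = y B.-ᶠ a
    Q = eval (divLinear a cs) y
    s = eval cs a
    y≡t+a : y ≡ t B.+ᶠ a
    y≡t+a = trans (sym (B.+-identityʳ y)) (trans (cong (y B.+ᶠ_) (sym (B.-‿inverseˡ a))) (sym (B.+-assoc _ _ _)))

  divLinear-zero : ∀ a p → AllZero (divLinear a p) → eval p a ≡ B.0# → AllZero p
  divLinear-zero a []       _ _ = []
  divLinear-zero a (c ∷ []) _ pa≡0 = trans (B.solve 2 (λ c a → c := c :+ a :* con 0) refl c a) pa≡0 ∷ []
  divLinear-zero a (c ∷ cs@(_ ∷ _)) (csa≡0 ∷ q≡0) pa≡0 = c≡0 ∷ divLinear-zero a cs q≡0 csa≡0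
    where
    c≡0 : c ≡ B.0#
    c≡0 = begin
      c                       ≡⟨ B.solve 2 (λ c a → c := c :+ a :* con 0) refl c a ⟩
      c B.+ᶠ a B.*ᶠ B.0#      ≡⟨ cong (λ u → c B.+ᶠ a B.*ᶠ u) (sym csa≡0) ⟩
      c B.+ᶠ a B.*ᶠ eval cs a ≡⟨ pa≡0 ⟩
      B.0#                    ∎
      where open ≡-Reasoning

  rootBound : ∀ r (pts : Fin r → B.Carrier) → (∀ i j → pts i ≡ pts j → i ≡ j) →
              ∀ p → length p ℕ.≤ r → (∀ i → eval p (pts i) ≡ B.0#) → AllZero p
  rootBound zero    pts inj []      _  _      = []
  rootBound (suc r) pts inj p       le vanish =
    divLinear-zero a p (rootBound r (λ i → pts (Fin.suc i)) (λ i j e → FinP.suc-injective (inj _ _ e))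
                                  (divLinear a p) length≤ vanish′)
                   (vanish Fin.zero)
    where
    a = pts Fin.zero
    length≤ : length (divLinear a p) ℕ.≤ r
    length≤ = subst (ℕ._≤ r) (sym (divLinear-length a p)) (ℕP.∸-monoˡ-≤ 1 le)
    vanish′ : ∀ i → eval (divLinear a p) (pts (Fin.suc i)) ≡ B.0#
    vanish′ i = B.nonzero-cancel y-a≢0 (begin
        (y B.-ᶠ a) B.*ᶠ eval (divLinear a p) y                    ≡⟨ sym (B.+-identityʳ _) ⟩
        (y B.-ᶠ a) B.*ᶠ eval (divLinear a p) y B.+ᶠ B.0#          ≡⟨ cong ((y B.-ᶠ a) B.*ᶠ eval (divLinear a p) y B.+ᶠ_) (sym (vanish Fin.zero)) ⟩
        (y B.-ᶠ a) B.*ᶠ eval (divLinear a p) y B.+ᶠ eval p a      ≡⟨ sym (divLinear-eval a p y) ⟩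
        eval p y                                                   ≡⟨ vanish (Fin.suc i) ⟩
        B.0#                                                       ∎)
      where
      open ≡-Reasoning
      y = pts (Fin.suc i)
      y-a≢0 : y B.-ᶠ a ≢ B.0#
      y-a≢0 e with inj (Fin.suc i) Fin.zero (B.sub≡0 y a e)
      ... | ()


-- Division with remainder by a monic polynomial  P = low + X^L  (L = length low > 0):
-- every p can be written p = P·quo + rem with rem of length exactly L.
module MonicDivision (A B : Field) (h : Field.Carrier A → Field.Carrier B) (hom : IsFieldHom A B h)
                     (low : List (Field.Carrier A)) where
  open PolyEval A B h hom
  open B using (_:+_; _:*_; _:=_; con)
  open Poly A

  L : ℕ
  L = length low

  -- remove the top coefficient (0 for the empty list)
  splitLast : List A.Carrier → List A.Carrier × A.Carrier
  splitLast []            = [] , A.0#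
  splitLast (r ∷ [])      = [] , r
  splitLast (r ∷ r′ ∷ rs) = (r ∷ proj₁ (splitLast (r′ ∷ rs))) , proj₂ (splitLast (r′ ∷ rs))

  splitLast-length : ∀ xs → length (proj₁ (splitLast xs)) ≡ length xs ℕ.∸ 1
  splitLast-length []            = refl
  splitLast-length (r ∷ [])      = refl
  splitLast-length (r ∷ r′ ∷ rs) = cong suc (splitLast-length (r′ ∷ rs))

  splitLast-eval : ∀ xs x → let (init , top) = splitLast xs in
                   eval xs x ≡ eval init x B.+ᶠ h top B.*ᶠ B.pow x (length init)
  splitLast-eval []            x = trans (B.solve 0 (con 0 := con 0 :+ con 0 :* con 1) refl)
                                         (cong (λ t → B.0# B.+ᶠ t B.*ᶠ B.1#) (sym pres-0))
  splitLast-eval (r ∷ [])      x = B.solve 2 (λ r x → r :+ x :* con 0 := con 0 :+ r :* con 1) refl (h r) x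
  splitLast-eval (r ∷ r′ ∷ rs) x = begin
      h r B.+ᶠ x B.*ᶠ eval (r′ ∷ rs) x
        ≡⟨ cong (λ t → h r B.+ᶠ x B.*ᶠ t) (splitLast-eval (r′ ∷ rs) x) ⟩
      h r B.+ᶠ x B.*ᶠ (eval init x B.+ᶠ h top B.*ᶠ B.pow x (length init))
        ≡⟨ B.solve 5 (λ r x e t p → r :+ x :* (e :+ t :* p) := (r :+ x :* e) :+ t :* (x :* p))
                     refl (h r) x (eval init x) (h top) (B.pow x (length init)) ⟩
      (h r B.+ᶠ x B.*ᶠ eval init x) B.+ᶠ h top B.*ᶠ (x B.*ᶠ B.pow x (length init)) ∎
    where
    open ≡-Reasoning
    init = proj₁ (splitLast (r′ ∷ rs))
    top  = proj₂ (splitLast (r′ ∷ rs))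

  addP-length : ∀ xs ys → length xs ≡ length ys → length (addP xs ys) ≡ length xs
  addP-length []       []       _ = refl
  addP-length (x ∷ xs) (y ∷ ys) e = cong suc (addP-length xs ys (ℕP.suc-injective e))

  -- long division, processing the coefficients from the top: the remainder of
  -- c + X·p is c + X·r − t·P, where t is the top coefficient of X·r
  divide : List A.Carrier → List A.Carrier × List A.Carrier
  divide []       = [] , replicate L A.0#
  divide (c ∷ cs) = (top ∷ proj₁ (divide cs)) , addP (c ∷ init) (map ((A.-ᶠ top) A.*ᶠ_) low)
    where
    init = proj₁ (splitLast (proj₂ (divide cs)))
    top  = proj₂ (splitLast (proj₂ (divide cs)))

  quotient remainder : List A.Carrier → List A.Carrier
  quotient  p = proj₁ (divide p)
  remainder p = proj₂ (divide p)

  evalP : B.Carrier → B.Carrier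
  evalP x = eval low x B.+ᶠ B.pow x L

  remainder-length : 0 ℕ.< L → ∀ p → length (remainder p) ≡ L
  remainder-length L>0 []       = ListP.length-replicate L
  remainder-length L>0 (c ∷ cs) = trans (addP-length (c ∷ init) (map ((A.-ᶠ top) A.*ᶠ_) low)
                                                    (trans len (sym (ListP.length-map _ low)))) len
    where
    init = proj₁ (splitLast (remainder cs))
    top  = proj₂ (splitLast (remainder cs))
    len : length (c ∷ init) ≡ L
    len = trans (cong suc (trans (splitLast-length (remainder cs)) (cong (ℕ._∸ 1) (remainder-length L>0 cs))))
                (ℕP.suc-pred L ⦃ ℕ.>-nonZero L>0 ⦄)

  divide-eval : 0 ℕ.< L → ∀ p x → eval p x ≡ evalP x B.*ᶠ eval (quotient p) x B.+ᶠ eval (remainder p) x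
  divide-eval L>0 []       x = sym (trans (cong₂ B._+ᶠ_ (B.zeroʳ _) (eval-zeros _ x (AllP.replicate⁺ L refl))) (B.+-identityʳ _))
  divide-eval L>0 (c ∷ cs) x = begin
      h c B.+ᶠ x B.*ᶠ eval cs x
        ≡⟨ B.x+y≡z⇒x≡z-y semiringStep ⟩
      (evalP x B.*ᶠ (ht B.+ᶠ x B.*ᶠ eQ) B.+ᶠ (h c B.+ᶠ x B.*ᶠ eI)) B.-ᶠ ht B.*ᶠ eL
        ≡⟨ B.+-assoc _ _ _ ⟩
      evalP x B.*ᶠ (ht B.+ᶠ x B.*ᶠ eQ) B.+ᶠ (eval (c ∷ init) x B.-ᶠ ht B.*ᶠ eL)
        ≡⟨ cong (λ u → evalP x B.*ᶠ (ht B.+ᶠ x B.*ᶠ eQ) B.+ᶠ (eval (c ∷ init) x B.+ᶠ u)) (sym eval-correction) ⟩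
      evalP x B.*ᶠ (ht B.+ᶠ x B.*ᶠ eQ) B.+ᶠ (eval (c ∷ init) x B.+ᶠ eval (map ((A.-ᶠ top) A.*ᶠ_) low) x)
        ≡⟨ cong (evalP x B.*ᶠ (ht B.+ᶠ x B.*ᶠ eQ) B.+ᶠ_) (sym (eval-add (c ∷ init) (map ((A.-ᶠ top) A.*ᶠ_) low) x)) ⟩
      evalP x B.*ᶠ eval (quotient (c ∷ cs)) x B.+ᶠ eval (remainder (c ∷ cs)) x ∎
    where
    open ≡-Reasoning
    R    = remainder cs
    init = proj₁ (splitLast R)
    top  = proj₂ (splitLast R)
    eQ   = eval (quotient cs) x
    eI   = eval init x
    eL   = eval low x
    ht   = h top
    xL′  = B.pow x (L ℕ.∸ 1)
    length-init : length init ≡ L ℕ.∸ 1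
    length-init = trans (splitLast-length R) (cong (ℕ._∸ 1) (remainder-length L>0 cs))
    evalP≡ : evalP x ≡ eL B.+ᶠ x B.*ᶠ xL′
    evalP≡ = cong (λ k → eL B.+ᶠ B.pow x k) (sym (ℕP.suc-pred L ⦃ ℕ.>-nonZero L>0 ⦄))
    eval-correction : eval (map ((A.-ᶠ top) A.*ᶠ_) low) x ≡ B.-ᶠ (ht B.*ᶠ eL)
    eval-correction = begin
      eval (map ((A.-ᶠ top) A.*ᶠ_) low) x ≡⟨ eval-scale (A.-ᶠ top) low x ⟩
      h (A.-ᶠ top) B.*ᶠ eL                ≡⟨ cong (B._*ᶠ eL) (pres-neg top) ⟩
      (B.-ᶠ ht) B.*ᶠ eL                   ≡⟨ sym (B.-‿distribˡ-* ht eL) ⟩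
      B.-ᶠ (ht B.*ᶠ eL)                   ∎
    -- c + X·(P·Q + R) + t·low = P·(t + X·Q) + (c + X·R_init), using R = R_init + t·X^(L−1)
    semiringStep : (h c B.+ᶠ x B.*ᶠ eval cs x) B.+ᶠ ht B.*ᶠ eL
                   ≡ evalP x B.*ᶠ (ht B.+ᶠ x B.*ᶠ eQ) B.+ᶠ (h c B.+ᶠ x B.*ᶠ eI)
    semiringStep = begin
      (h c B.+ᶠ x B.*ᶠ eval cs x) B.+ᶠ ht B.*ᶠ eL
        ≡⟨ cong (λ u → (h c B.+ᶠ x B.*ᶠ u) B.+ᶠ ht B.*ᶠ eL) (divide-eval L>0 cs x) ⟩
      (h c B.+ᶠ x B.*ᶠ (evalP x B.*ᶠ eQ B.+ᶠ eval R x)) B.+ᶠ ht B.*ᶠ eL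
        ≡⟨ cong (λ u → (h c B.+ᶠ x B.*ᶠ (evalP x B.*ᶠ eQ B.+ᶠ u)) B.+ᶠ ht B.*ᶠ eL) (splitLast-eval R x) ⟩
      (h c B.+ᶠ x B.*ᶠ (evalP x B.*ᶠ eQ B.+ᶠ (eI B.+ᶠ ht B.*ᶠ B.pow x (length init)))) B.+ᶠ ht B.*ᶠ eL
        ≡⟨ cong₂ (λ k E → (h c B.+ᶠ x B.*ᶠ (E B.*ᶠ eQ B.+ᶠ (eI B.+ᶠ ht B.*ᶠ B.pow x k))) B.+ᶠ ht B.*ᶠ eL) length-init evalP≡ ⟩
      (h c B.+ᶠ x B.*ᶠ ((eL B.+ᶠ x B.*ᶠ xL′) B.*ᶠ eQ B.+ᶠ (eI B.+ᶠ ht B.*ᶠ xL′))) B.+ᶠ ht B.*ᶠ eL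
        ≡⟨ B.solve 7 (λ c x l p q e t → (c :+ x :* ((l :+ x :* p) :* q :+ (e :+ t :* p))) :+ t :* l
                                       := (l :+ x :* p) :* (t :+ x :* q) :+ (c :+ x :* e))
                     refl (h c) x eL xL′ eQ eI ht ⟩
      (eL B.+ᶠ x B.*ᶠ xL′) B.*ᶠ (ht B.+ᶠ x B.*ᶠ eQ) B.+ᶠ (h c B.+ᶠ x B.*ᶠ eI)
        ≡⟨ cong (λ E → E B.*ᶠ (ht B.+ᶠ x B.*ᶠ eQ) B.+ᶠ (h c B.+ᶠ x B.*ᶠ eI)) (sym evalP≡) ⟩
      evalP x B.*ᶠ (ht B.+ᶠ x B.*ᶠ eQ) B.+ᶠ (h c B.+ᶠ x B.*ᶠ eI) ∎


module MonicProduct (B : Field) where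
  open FieldFacts B
  open Poly B

  Monic : ℕ → List Carrier → Set
  Monic k p = Σ (List Carrier) λ low → Σ Carrier λ c → (p ≡ low ++ c ∷ []) × (length low ≡ k) × (c ≡ 1#)

  addP-snoc : ∀ xs low c → length xs ℕ.≤ length low → addP xs (low ++ c ∷ []) ≡ addP xs low ++ c ∷ []
  addP-snoc []       low       c _           = refl
  addP-snoc (x ∷ xs) (l ∷ low) c (ℕ.s≤s le) = cong ((x +ᶠ l) ∷_) (addP-snoc xs low c le)

  addP-length : ∀ xs low → length xs ℕ.≤ length low → length (addP xs low) ≡ length low
  addP-length []       low       _           = refl
  addP-length (x ∷ xs) (l ∷ low) (ℕ.s≤s le) = cong suc (addP-length xs low le)

  addP-[] : ∀ xs → addP xs [] ≡ xs
  addP-[] []       = refl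
  addP-[] (x ∷ xs) = refl

  monic-mulLinear : ∀ a k p → Monic k p → Monic (suc k) (mulP (a ∷ 1# ∷ []) p)
  monic-mulLinear a k .([] ++ c ∷ []) ([] , c , refl , k≡0 , c≡1) =
    (a *ᶠ c +ᶠ 0# ∷ []) , (1# *ᶠ c +ᶠ 0#) , refl , cong suc k≡0 , trans (+-identityʳ _) (trans (*-identityˡ c) c≡1)
  monic-mulLinear a k .((l ∷ low) ++ c ∷ []) ((l ∷ low) , c , refl , len≡k , c≡1) =
    addP (map (a *ᶠ_) p) shifted , 1# *ᶠ c , product≡ ,
    trans (addP-length (map (a *ᶠ_) p) shifted length≤) (cong suc (trans (cong suc (ListP.length-map _ low)) len≡k)) ,
    trans (*-identityˡ c) c≡1
    where
    p       = (l ∷ low) ++ c ∷ []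
    shifted = 0# ∷ (1# *ᶠ l +ᶠ 0#) ∷ map (1# *ᶠ_) low
    length≤ : length (map (a *ᶠ_) p) ℕ.≤ length shifted
    length≤ = ℕP.≤-reflexive (begin
      length (map (a *ᶠ_) p)          ≡⟨ ListP.length-map _ p ⟩
      length p                        ≡⟨ ListP.length-++ (l ∷ low) ⟩
      suc (length low ℕ.+ 1)          ≡⟨ cong suc (ℕP.+-comm (length low) 1) ⟩
      suc (suc (length low))          ≡⟨ cong (suc ∘ suc) (sym (ListP.length-map _ low)) ⟩
      length shifted                  ∎)
      where open ≡-Reasoning
    product≡ : mulP (a ∷ 1# ∷ []) p ≡ addP (map (a *ᶠ_) p) shifted ++ 1# *ᶠ c ∷ []
    product≡ = trans (cong (λ t → addP (map (a *ᶠ_) p) (0# ∷ (1# *ᶠ l +ᶠ 0#) ∷ t))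
                           (trans (addP-[] _) (ListP.map-++ (1# *ᶠ_) low (c ∷ []))))
                     (addP-snoc (map (a *ᶠ_) p) shifted (1# *ᶠ c) length≤)

  monic-product : (root : ℕ → Carrier) → ∀ js →
                  Monic (length js) (foldr mulP (1# ∷ []) (map (λ j → root j ∷ 1# ∷ []) js))
  monic-product root []       = [] , 1# , refl , refl , refl
  monic-product root (j ∷ js) = monic-mulLinear (root j) (length js) _ (monic-product root js)

map-snoc⁻ : ∀ {A C : Set} (f : A → C) xs ys c → map f xs ≡ ys ++ c ∷ [] →
            Σ (List A) λ xs₁ → Σ A λ d → (xs ≡ xs₁ ++ d ∷ []) × (map f xs₁ ≡ ys) × (f d ≡ c)
map-snoc⁻ f []            []       c ()
map-snoc⁻ f []            (y ∷ ys) c ()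
map-snoc⁻ f (x ∷ [])      []       c e = [] , x , refl , refl , ListP.∷-injectiveˡ e
map-snoc⁻ f (x ∷ x′ ∷ xs) []       c e with ListP.∷-injectiveʳ e
... | ()
map-snoc⁻ f (x ∷ xs)      (y ∷ ys) c e with map-snoc⁻ f xs ys c (ListP.∷-injectiveʳ e)
... | xs₁ , d , xs≡ , map≡ , fd≡c = x ∷ xs₁ , d , cong (x ∷_) xs≡ , cong₂ _∷_ (ListP.∷-injectiveˡ e) map≡ , fd≡c


module Arithmetic where
  open import Data.Nat using (_+_; _*_; _^_; _≤_; _<_; _∸_; NonZero; z≤n; s≤s)
  open ℕP
  open import Data.Nat.DivMod
  open import Data.Nat.Divisibility using (_∣_; divides)

  div'≡ : ∀ a b .{{_ : NonZero b}} → div' a b ≡ a / b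
  div'≡ a (suc b) = refl

  mod'≡ : ∀ a b .{{_ : NonZero b}} → mod' a b ≡ a % b
  mod'≡ a (suc b) = refl

  [bk+v]%k≡v : ∀ b v k .{{_ : NonZero k}} → v < k → (b * k + v) % k ≡ v
  [bk+v]%k≡v b v k v<k = trans (cong (_% k) (+-comm (b * k) v)) (trans ([m+kn]%n≡m%n v b k) (m<n⇒m%n≡m v<k))

  [bk+v]/k≡b : ∀ b v k .{{_ : NonZero k}} → v < k → (b * k + v) / k ≡ b
  [bk+v]/k≡b b v k v<k = begin
      (b * k + v) / k        ≡⟨ +-distrib-/ (b * k) v (subst (_< k) (sym (trans (cong (_+ v % k) (m*n%n≡0 b k))
                                                                               (m<n⇒m%n≡m v<k))) v<k) ⟩
      b * k / k + v / k      ≡⟨ cong₂ _+_ (m*n/n≡m b k) (m<n⇒m/n≡0 v<k) ⟩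
      b + 0                  ≡⟨ +-identityʳ b ⟩
      b                      ∎
    where open ≡-Reasoning

  divmod-unique : ∀ b v b′ v′ k → v < k → v′ < k → b * k + v ≡ b′ * k + v′ → b ≡ b′ × v ≡ v′
  divmod-unique b v b′ v′ k@(suc _) v<k v′<k e =
    trans (sym ([bk+v]/k≡b b v k v<k)) (trans (cong (_/ k) e) ([bk+v]/k≡b b′ v′ k v′<k)) ,
    trans (sym ([bk+v]%k≡v b v k v<k)) (trans (cong (_% k) e) ([bk+v]%k≡v b′ v′ k v′<k))

  pred<self : ∀ {m} → 0 < m → m ∸ 1 < m
  pred<self 0<m = ∸-monoʳ-< {n = 1} {o = 0} (s≤s z≤n) 0<m

  divmod-bound : ∀ b D v k → b < D → v < k → b * k + v < D * k
  divmod-bound b D v k b<D v<k = begin-strict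
      b * k + v   <⟨ +-monoʳ-< (b * k) v<k ⟩
      b * k + k   ≡⟨ +-comm (b * k) k ⟩
      suc b * k   ≤⟨ *-monoˡ-≤ k b<D ⟩
      D * k       ∎
    where open ≤-Reasoning

  %-≡⇒∣∸ : ∀ {n} .{{_ : NonZero n}} a b → a % n ≡ b % n → n ∣ a ∸ b
  %-≡⇒∣∸ {n} a b e = divides (a / n ∸ b / n) (begin
      a ∸ b                                     ≡⟨ cong₂ _∸_ (m≡m%n+[m/n]*n a n) (m≡m%n+[m/n]*n b n) ⟩
      (a % n + a / n * n) ∸ (b % n + b / n * n) ≡⟨ cong (λ t → (t + a / n * n) ∸ (b % n + b / n * n)) e ⟩
      (b % n + a / n * n) ∸ (b % n + b / n * n) ≡⟨ [m+n]∸[m+o]≡n∸o (b % n) (a / n * n) (b / n * n) ⟩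
      a / n * n ∸ b / n * n                     ≡⟨ sym (*-distribʳ-∸ n (a / n) (b / n)) ⟩
      (a / n ∸ b / n) * n                       ∎)
    where open ≡-Reasoning

  ∣∸⇒%≡ : ∀ {n} .{{_ : NonZero n}} a b → b ≤ a → n ∣ a ∸ b → a % n ≡ b % n
  ∣∸⇒%≡ {n} a b b≤a d = trans (cong (_% n) (sym (m+[n∸m]≡n b≤a))) (%-remove-+ʳ b d)

  mul-mod : ∀ {n} .{{_ : NonZero n}} a x → (a * (x % n)) % n ≡ (a * x) % n
  mul-mod {n} a x = trans (%-distribˡ-* a (x % n) n)
                          (trans (cong (λ t → ((a % n) * t) % n) (m%n%n≡m%n x n)) (sym (%-distribˡ-* a x n)))

  module Digits (Q : ℕ) .{{_ : NonZero Q}} where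

    dig : ℕ → ℕ → ℕ
    dig N j = (_/_ N (Q ^ j) ⦃ m^n≢0 Q j ⦄) % Q

    dig< : ∀ N j → dig N j < Q
    dig< N j = m%n<n (_/_ N (Q ^ j) ⦃ m^n≢0 Q j ⦄) Q

    dig-suc : ∀ N j → dig N (suc j) ≡ dig (N / Q) j
    dig-suc N j = cong (_% Q) (sym (m/n/o≡m/[n*o] N Q (Q ^ j) ⦃ _ ⦄ ⦃ m^n≢0 Q j ⦄ ⦃ m^n≢0 Q (suc j) ⦄))

    dig-0 : ∀ N → dig N 0 ≡ N % Q
    dig-0 N = cong (_% Q) (n/1≡n N)

    split : ∀ N → N ≡ N % Q + Q * (N / Q)
    split N = trans (m≡m%n+[m/n]*n N Q) (cong (N % Q +_) (*-comm (N / Q) Q))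

    /Q< : ∀ {N L} → N < Q ^ suc L → N / Q < Q ^ L
    /Q< {N} {L} lt = m<n*o⇒m/o<n (subst (N <_) (*-comm Q (Q ^ L)) lt)

    dig-unique : ∀ L N N′ → N < Q ^ L → N′ < Q ^ L → (∀ j → j < L → dig N j ≡ dig N′ j) → N ≡ N′
    dig-unique zero    N N′ (s≤s z≤n) (s≤s z≤n) _ = refl
    dig-unique (suc L) N N′ lt lt′ same = begin
        N                      ≡⟨ split N ⟩
        N % Q + Q * (N / Q)    ≡⟨ cong₂ (λ a b → a + Q * b) low high ⟩
        N′ % Q + Q * (N′ / Q)  ≡⟨ sym (split N′) ⟩
        N′                     ∎
      where
      open ≡-Reasoning
      low : N % Q ≡ N′ % Q
      low = trans (sym (dig-0 N)) (trans (same 0 (s≤s z≤n)) (dig-0 N′))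
      high : N / Q ≡ N′ / Q
      high = dig-unique L (N / Q) (N′ / Q) (/Q< {N} {L} lt) (/Q< {N′} {L} lt′)
               (λ j j<L → trans (sym (dig-suc N j)) (trans (same (suc j) (s≤s j<L)) (dig-suc N′ j)))

    dig-all-max : ∀ L N → N < Q ^ L → (∀ j → j < L → dig N j ≡ Q ∸ 1) → suc N ≡ Q ^ L
    dig-all-max zero    N (s≤s z≤n) _ = refl
    dig-all-max (suc L) N lt allMax = begin
        suc N                         ≡⟨ cong suc (split N) ⟩
        suc (N % Q) + Q * (N / Q)     ≡⟨ cong (λ a → suc a + Q * (N / Q)) (trans (sym (dig-0 N)) (allMax 0 (s≤s z≤n))) ⟩
        suc (Q ∸ 1) + Q * (N / Q)     ≡⟨ cong (_+ Q * (N / Q)) (suc-pred Q) ⟩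
        Q + Q * (N / Q)               ≡⟨ sym (*-suc Q (N / Q)) ⟩
        Q * suc (N / Q)               ≡⟨ cong (Q *_) rest ⟩
        Q ^ suc L                     ∎
      where
      open ≡-Reasoning
      rest : suc (N / Q) ≡ Q ^ L
      rest = dig-all-max L (N / Q) (/Q< {N} {L} lt) (λ j j<L → trans (sym (dig-suc N j)) (allMax (suc j) (s≤s j<L)))

    enc : ∀ {L} → (Fin L → ℕ) → ℕ
    enc {zero}  v = 0
    enc {suc L} v = v Fin.zero + Q * enc (λ j → v (Fin.suc j))

    enc< : ∀ {L} (v : Fin L → ℕ) → (∀ j → v j < Q) → enc v < Q ^ L
    enc< {zero}  v _     = s≤s z≤n
    enc< {suc L} v v<Q = begin-strict
        v Fin.zero + Q * enc (λ j → v (Fin.suc j)) <⟨ +-monoˡ-< _ (v<Q Fin.zero) ⟩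
        Q + Q * enc (λ j → v (Fin.suc j))          ≡⟨ sym (*-suc Q _) ⟩
        Q * suc (enc (λ j → v (Fin.suc j)))        ≤⟨ *-monoʳ-≤ Q (enc< (λ j → v (Fin.suc j)) (λ j → v<Q (Fin.suc j))) ⟩
        Q * Q ^ L                                  ∎
      where open ≤-Reasoning

    enc-as-divmod : ∀ {L} (v : Fin (suc L) → ℕ) → enc v ≡ enc (λ j → v (Fin.suc j)) * Q + v Fin.zero
    enc-as-divmod v = trans (+-comm (v Fin.zero) _) (cong (_+ v Fin.zero) (*-comm Q _))

    dig-enc : ∀ {L} (v : Fin L → ℕ) → (∀ j → v j < Q) → ∀ j → dig (enc v) (toℕ j) ≡ v j
    dig-enc {suc L} v v<Q Fin.zero    = begin
        dig (enc v) 0                                   ≡⟨ dig-0 (enc v) ⟩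
        enc v % Q                                       ≡⟨ cong (_% Q) (enc-as-divmod v) ⟩
        (enc (λ j → v (Fin.suc j)) * Q + v Fin.zero) % Q ≡⟨ [bk+v]%k≡v (enc (λ j → v (Fin.suc j))) _ Q (v<Q Fin.zero) ⟩
        v Fin.zero                                      ∎
      where open ≡-Reasoning
    dig-enc {suc L} v v<Q (Fin.suc j) = begin
        dig (enc v) (suc (toℕ j))                        ≡⟨ dig-suc (enc v) (toℕ j) ⟩
        dig (enc v / Q) (toℕ j)                          ≡⟨ cong (λ t → dig (t / Q) (toℕ j)) (enc-as-divmod v) ⟩
        dig ((enc (λ j → v (Fin.suc j)) * Q + v Fin.zero) / Q) (toℕ j)
                                                        ≡⟨ cong (λ t → dig t (toℕ j)) ([bk+v]/k≡b _ _ Q (v<Q Fin.zero)) ⟩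
        dig (enc (λ j → v (Fin.suc j))) (toℕ j)          ≡⟨ dig-enc (λ j → v (Fin.suc j)) (λ j → v<Q (Fin.suc j)) j ⟩
        v (Fin.suc j)                                   ∎
      where open ≡-Reasoning


module Finite where
  open import Data.Sum using (_⊎_; inj₁; inj₂; [_,_]′)

  -- a map Fin (K+1) → Fin (K+1) missing a point has a collision (pigeonhole into K points)
  pigeonhole-avoiding : ∀ {K} (f : Fin (suc K) → Fin (suc K)) (z : Fin (suc K)) → (∀ i → f i ≢ z) →
                        Σ (Fin (suc K)) λ i → Σ (Fin (suc K)) λ j → i Fin.< j × f i ≡ f j
  pigeonhole-avoiding {K} f z avoid
    with FinP.pigeonhole (ℕP.n<1+n K) (λ i → Fin.punchOut {i = z} {j = f i} (λ e → avoid i (sym e)))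
  ... | i , j , i<j , e = i , j , i<j , FinP.punchOut-injective (λ e → avoid i (sym e)) (λ e → avoid j (sym e)) e

  -- if f missed y, pigeonhole would produce a collision
  injective⇒surjective : ∀ {N} (f : Fin N → Fin N) → (∀ i j → f i ≡ f j → i ≡ j) → ∀ y → Σ (Fin N) λ i → f i ≡ y
  injective⇒surjective {suc K} f inj y with FinP.any? (λ i → f i FinP.≟ y)
  ... | yes hit = hit
  ... | no miss with pigeonhole-avoiding f y (λ i e → miss (i , e))
  ... | i , j , i<j , e = ⊥-elim (ℕP.<-irrefl (cong toℕ (inj i j e)) i<j)

  least : (P : ℕ → Set) → (∀ k → Dec (P k)) → ∀ k → P k → Σ ℕ λ m → P m × (∀ j → j ℕ.< m → ¬ P j)
  least P P? k pk with search (suc k)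
    where
    search : ∀ b → (∀ j → j ℕ.< b → ¬ P j) ⊎ (Σ ℕ λ m → P m × (∀ j → j ℕ.< m → ¬ P j))
    search zero = inj₁ (λ j ())
    search (suc b) with search b
    ... | inj₂ found = inj₂ found
    ... | inj₁ none with P? b
    ...   | yes pb  = inj₂ (b , pb , none)
    ...   | no ¬pb  = inj₁ (λ j j<1+b pj → [ (λ j<b → none j j<b pj) , (λ { refl → ¬pb pj }) ]′
                                             (ℕP.m≤n⇒m<n∨m≡n (ℕ.s≤s⁻¹ j<1+b)))
  ... | inj₁ none  = ⊥-elim (none k (ℕP.n<1+n k) pk)
  ... | inj₂ found = found


∈⇒lookup : ∀ {k} {I : Subset k} {i} → i ∈ I → Data.Vec.lookup I i ≡ true
∈⇒lookup = VecP.[]=⇒lookup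

∉⇒lookup : ∀ {k} {I : Subset k} {i} → i ∉ I → Data.Vec.lookup I i ≡ false
∉⇒lookup {I = I} {i} i∉I with Data.Vec.lookup I i in e
... | true  = ⊥-elim (i∉I (VecP.lookup⇒[]= i I e))
... | false = refl

subset-ext : ∀ {k} (I J : Subset k) → (∀ i → i ∉ J → i ∉ I) → (∀ i → i ∉ I → i ∉ J) → I ≡ J
subset-ext I J ∁J⊆∁I ∁I⊆∁J = ⊆-antisym (within ∁J⊆∁I) (within ∁I⊆∁J)
  where
  within : ∀ {A B : Subset _} → (∀ i → i ∉ B → i ∉ A) → ∀ {i} → i ∈ A → i ∈ B
  within {B = B} ∁B⊆∁A {i} i∈A with i ∈? B
  ... | yes i∈B = i∈B
  ... | no  i∉B = ⊥-elim (∁B⊆∁A i i∉B i∈A)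


module CyclotomicClasses (S : Setup) where
  open SetupDefs S
  open import Data.Nat using (_+_; _*_; _^_; _≤_; _<_; _∸_; NonZero)
  open ℕP
  open import Data.Nat.DivMod
  open import Data.Nat.Divisibility using (_∣_)
  open import Data.Nat.Coprimality using (coprime-divisor)
  open import Data.Sum using (inj₁; inj₂)
  open import Relation.Binary using (tri<; tri≈; tri>)
  open Arithmetic

  private instance
    n≢0 : NonZero n
    n≢0 = nz

  toℕ-red : ∀ k → toℕ (red k) ≡ k % n
  toℕ-red k = FinP.toℕ-fromℕ< _

  toℕ-pt : ∀ i j → toℕ (pt i j) ≡ (q ^ j * toℕ (s i)) % n
  toℕ-pt i j = toℕ-red _

  s%n : ∀ i → toℕ (s i) % n ≡ toℕ (s i)
  s%n i = m<n⇒m%n≡m (FinP.toℕ<n (s i))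

  pow-mod : ∀ a b x → (q ^ b * ((q ^ a * x) % n)) % n ≡ (q ^ (b + a) * x) % n
  pow-mod a b x = begin
      (q ^ b * ((q ^ a * x) % n)) % n ≡⟨ mul-mod (q ^ b) _ ⟩
      (q ^ b * (q ^ a * x)) % n       ≡⟨ cong (_% n) (sym (*-assoc (q ^ b) _ _)) ⟩
      (q ^ b * q ^ a * x) % n         ≡⟨ cong (λ t → (t * x) % n) (sym (^-distribˡ-+-* q b a)) ⟩
      (q ^ (b + a) * x) % n           ∎
    where open ≡-Reasoning

  pt-suc : ∀ i j → red (q * toℕ (pt i j)) ≡ pt i (suc j)
  pt-suc i j = FinP.toℕ-injective (begin
      toℕ (red (q * toℕ (pt i j)))               ≡⟨ toℕ-red _ ⟩
      (q * toℕ (pt i j)) % n                     ≡⟨ cong₂ (λ a b → (a * b) % n) (sym (*-identityʳ q)) (toℕ-pt i j) ⟩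
      (q ^ 1 * ((q ^ j * toℕ (s i)) % n)) % n    ≡⟨ pow-mod j 1 _ ⟩
      (q ^ (1 + j) * toℕ (s i)) % n              ≡⟨ sym (toℕ-pt i (suc j)) ⟩
      toℕ (pt i (suc j))                         ∎)
    where open ≡-Reasoning

  pt-0 : ∀ i → pt i 0 ≡ s i
  pt-0 i = FinP.toℕ-injective (trans (toℕ-pt i 0) (trans (cong (_% n) (*-identityˡ (toℕ (s i)))) (s%n i)))

  pt-+ℓ : ∀ i j → pt i (j + ℓ i) ≡ pt i j
  pt-+ℓ i j = FinP.toℕ-injective (begin
      toℕ (pt i (j + ℓ i))                        ≡⟨ toℕ-pt i (j + ℓ i) ⟩
      (q ^ (j + ℓ i) * toℕ (s i)) % n             ≡⟨ sym (pow-mod (ℓ i) j _) ⟩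
      (q ^ j * ((q ^ ℓ i * toℕ (s i)) % n)) % n   ≡⟨ cong (λ t → (q ^ j * t) % n) (trans (sym (toℕ-pt i (ℓ i))) (cong toℕ (ℓ-period i))) ⟩
      (q ^ j * toℕ (s i)) % n                     ≡⟨ sym (toℕ-pt i j) ⟩
      toℕ (pt i j)                                ∎)
    where open ≡-Reasoning

  ℓ≢0 : ∀ i → NonZero (ℓ i)
  ℓ≢0 i = ℕ.>-nonZero (ℓ-pos i)

  pt-mod : ∀ i j → pt i j ≡ pt i (_%_ j (ℓ i) ⦃ ℓ≢0 i ⦄)
  pt-mod i j = trans (cong (pt i) (m≡m%n+[m/n]*n j (ℓ i) ⦃ ℓ≢0 i ⦄)) (periodic (_%_ j (ℓ i) ⦃ ℓ≢0 i ⦄) (_/_ j (ℓ i) ⦃ ℓ≢0 i ⦄))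
    where
    periodic : ∀ r k → pt i (r + k * ℓ i) ≡ pt i r
    periodic r zero    = cong (pt i) (+-identityʳ r)
    periodic r (suc k) = trans (cong (pt i) (trans (cong (r +_) (+-comm (ℓ i) (k * ℓ i))) (sym (+-assoc r _ _))))
                               (trans (pt-+ℓ i (r + k * ℓ i)) (periodic r k))

  -- q is invertible modulo n, so multiplication by q^a can be cancelled
  coprime-pow : ∀ a z → n ∣ q ^ a * z → n ∣ z
  coprime-pow zero    z d = subst (n ∣_) (+-identityʳ z) d
  coprime-pow (suc a) z d = coprime-pow a z (coprime-divisor coprime (subst (n ∣_) (*-assoc q (q ^ a) z) d))

  cancel-q : ∀ a x y → (q ^ a * x) % n ≡ (q ^ a * y) % n → x % n ≡ y % n
  cancel-q a x y e with ≤-total y x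
  ... | inj₁ y≤x = ∣∸⇒%≡ x y y≤x (coprime-pow a (x ∸ y) (subst (n ∣_) (sym (*-distribˡ-∸ (q ^ a) x y)) (%-≡⇒∣∸ _ _ e)))
  ... | inj₂ x≤y = sym (∣∸⇒%≡ y x x≤y (coprime-pow a (y ∸ x) (subst (n ∣_) (sym (*-distribˡ-∸ (q ^ a) y x)) (%-≡⇒∣∸ _ _ (sym e)))))

  -- minimality of ℓ_i: the points pt i j, j < ℓ_i, are distinct
  pt-distinct : ∀ i j j′ → j < j′ → j′ < ℓ i → pt i j ≢ pt i j′
  pt-distinct i j j′ j<j′ j′<ℓ e = ℓ-least i d (m<n⇒0<n∸m j<j′) (≤-<-trans (m∸n≤m j′ j) j′<ℓ)
                                    (FinP.toℕ-injective (trans (toℕ-pt i d) (trans (sym (cancel-q j _ _ shifted)) (s%n i))))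
    where
    d = j′ ∸ j
    shifted : (q ^ j * toℕ (s i)) % n ≡ (q ^ j * (q ^ d * toℕ (s i))) % n
    shifted = begin
      (q ^ j * toℕ (s i)) % n           ≡⟨ sym (toℕ-pt i j) ⟩
      toℕ (pt i j)                      ≡⟨ cong toℕ e ⟩
      toℕ (pt i j′)                     ≡⟨ toℕ-pt i j′ ⟩
      (q ^ j′ * toℕ (s i)) % n          ≡⟨ cong (λ k → (q ^ k * toℕ (s i)) % n) (sym (m+[n∸m]≡n (<⇒≤ j<j′))) ⟩
      (q ^ (j + d) * toℕ (s i)) % n     ≡⟨ cong (λ t → (t * toℕ (s i)) % n) (^-distribˡ-+-* q j d) ⟩
      (q ^ j * q ^ d * toℕ (s i)) % n   ≡⟨ cong (_% n) (*-assoc (q ^ j) _ _) ⟩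
      (q ^ j * (q ^ d * toℕ (s i))) % n ∎
      where open ≡-Reasoning

  pt-injective : ∀ i j j′ → j < ℓ i → j′ < ℓ i → pt i j ≡ pt i j′ → j ≡ j′
  pt-injective i j j′ j< j′< e with <-cmp j j′
  ... | tri< j<j′ _ _ = ⊥-elim (pt-distinct i j j′ j<j′ j′< e)
  ... | tri≈ _ j≡j′ _ = j≡j′
  ... | tri> _ _ j>j′ = ⊥-elim (pt-distinct i j′ j j>j′ j< (sym e))

  -- some power q^T with T > 0 is 1 modulo n (pigeonhole on q^0, …, q^n mod n)
  order-mod-n : Σ ℕ λ T → 0 < T × (q ^ T) % n ≡ 1 % n
  order-mod-n with FinP.pigeonhole (n<1+n n) (λ (k : Fin (suc n)) → red (q ^ toℕ k))
  ... | a , b , a<b , e = d , m<n⇒0<n∸m a<b , sym (cancel-q (toℕ a) 1 (q ^ d) same)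
    where
    d = toℕ b ∸ toℕ a
    same : (q ^ toℕ a * 1) % n ≡ (q ^ toℕ a * q ^ d) % n
    same = begin
      (q ^ toℕ a * 1) % n       ≡⟨ cong (_% n) (*-identityʳ _) ⟩
      (q ^ toℕ a) % n           ≡⟨ sym (toℕ-red _) ⟩
      toℕ (red (q ^ toℕ a))     ≡⟨ cong toℕ e ⟩
      toℕ (red (q ^ toℕ b))     ≡⟨ toℕ-red _ ⟩
      (q ^ toℕ b) % n           ≡⟨ cong (λ k → (q ^ k) % n) (sym (m+[n∸m]≡n (<⇒≤ a<b))) ⟩
      (q ^ (toℕ a + d)) % n     ≡⟨ cong (_% n) (^-distribˡ-+-* q (toℕ a) d) ⟩
      (q ^ toℕ a * q ^ d) % n   ∎
      where open ≡-Reasoning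

  Orbit : Fin n → Fin n → Set
  Orbit z w = Σ ℕ λ a → toℕ w ≡ (q ^ a * toℕ z) % n

  orbit-refl : ∀ z → Orbit z z
  orbit-refl z = 0 , sym (trans (cong (_% n) (*-identityˡ (toℕ z))) (m<n⇒m%n≡m (FinP.toℕ<n z)))

  orbit-trans : ∀ {z w v} → Orbit z w → Orbit w v → Orbit z v
  orbit-trans {z} (a , w≡) (b , v≡) = b + a , trans v≡ (trans (cong (λ t → (q ^ b * t) % n) w≡) (pow-mod a b (toℕ z)))

  -- symmetry: go around the orbit, q^(aT − a) undoes q^a
  orbit-sym : ∀ {z w} → Orbit z w → Orbit w z
  orbit-sym {z} {w} (a , w≡) = a * T ∸ a , (begin
      toℕ z                                       ≡⟨ sym (m<n⇒m%n≡m (FinP.toℕ<n z)) ⟩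
      toℕ z % n                                   ≡⟨ sym (powT a) ⟩
      (q ^ (a * T) * toℕ z) % n                   ≡⟨ cong (λ k → (q ^ k * toℕ z) % n) (sym (m∸n+n≡m (m≤m*n a T ⦃ ℕ.>-nonZero T>0 ⦄))) ⟩
      (q ^ (a * T ∸ a + a) * toℕ z) % n           ≡⟨ sym (pow-mod a (a * T ∸ a) (toℕ z)) ⟩
      (q ^ (a * T ∸ a) * ((q ^ a * toℕ z) % n)) % n ≡⟨ cong (λ t → (q ^ (a * T ∸ a) * t) % n) (sym w≡) ⟩
      (q ^ (a * T ∸ a) * toℕ w) % n               ∎)
    where
    open ≡-Reasoning
    T : ℕ
    T = proj₁ order-mod-n
    T>0 : 0 < T
    T>0 = proj₁ (proj₂ order-mod-n)
    powT : ∀ k → (q ^ (k * T) * toℕ z) % n ≡ toℕ z % n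
    powT zero    = cong (_% n) (*-identityˡ (toℕ z))
    powT (suc k) = begin
      (q ^ (T + k * T) * toℕ z) % n                ≡⟨ sym (pow-mod (k * T) T (toℕ z)) ⟩
      (q ^ T * ((q ^ (k * T) * toℕ z) % n)) % n    ≡⟨ cong (λ t → (q ^ T * t) % n) (powT k) ⟩
      (q ^ T * (toℕ z % n)) % n                    ≡⟨ mul-mod (q ^ T) (toℕ z) ⟩
      (q ^ T * toℕ z) % n                          ≡⟨ %-distribˡ-* (q ^ T) (toℕ z) n ⟩
      ((q ^ T % n) * (toℕ z % n)) % n              ≡⟨ cong (λ a → (a * (toℕ z % n)) % n) (proj₂ (proj₂ order-mod-n)) ⟩
      ((1 % n) * (toℕ z % n)) % n                  ≡⟨ sym (%-distribˡ-* 1 (toℕ z) n) ⟩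
      (1 * toℕ z) % n                              ≡⟨ cong (_% n) (*-identityˡ (toℕ z)) ⟩
      toℕ z % n                                    ∎

  gen⇒orbit : ∀ {z w} → Gen q n nz z w → Orbit z w
  gen⇒orbit (step z)     = 1 , trans (toℕ-red _) (cong (λ t → (t * toℕ z) % n) (sym (*-identityʳ q)))
  gen⇒orbit (refl′ z)    = orbit-refl z
  gen⇒orbit (sym′ g)     = orbit-sym (gen⇒orbit g)
  gen⇒orbit (trans′ g h) = orbit-trans (gen⇒orbit g) (gen⇒orbit h)

  Gen-pt : ∀ i j → Gen q n nz (s i) (pt i j)
  Gen-pt i zero    = subst (Gen q n nz (s i)) (sym (pt-0 i)) (refl′ (s i))
  Gen-pt i (suc j) = trans′ (Gen-pt i j) (subst (Gen q n nz (pt i j)) (pt-suc i j) (step (pt i j)))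

  cover : ∀ z → Σ (Fin m) λ i → Σ ℕ λ j → j < ℓ i × z ≡ pt i j
  cover z with s-cover z
  ... | i , g with orbit-sym (gen⇒orbit g)
  ... | a , z≡ = i , _%_ a (ℓ i) ⦃ ℓ≢0 i ⦄ , m%n<n a (ℓ i) ⦃ ℓ≢0 i ⦄ ,
                 trans (FinP.toℕ-injective (trans z≡ (sym (toℕ-pt i a)))) (pt-mod i a)

  unique : ∀ i j i′ j′ → j < ℓ i → j′ < ℓ i′ → pt i j ≡ pt i′ j′ → Σ (i ≡ i′) λ { refl → j ≡ j′ }
  unique i j i′ j′ j< j′< e
    with s-distinct i i′ (trans′ (Gen-pt i j) (subst (λ z → Gen q n nz z (s i′)) (sym e) (sym′ (Gen-pt i′ j′))))
  ... | refl = refl , pt-injective i j j′ j< j′< e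


-- The numbers n_i = n / gcd(n, s_i) and D_i = (q^ℓ_i − 1)·gcd(n, s_i) / n:
-- n_i divides q^ℓ_i − 1 (because n ∣ (q^ℓ_i − 1)·s_i) and D_i · n_i = q^ℓ_i − 1.
module ClassNumbers (S : Setup) where
  open SetupDefs S
  open import Data.Nat using (_*_; _^_; _≤_; _<_; _∸_; NonZero; z≤n; s≤s)
  open ℕP
  open import Data.Nat.DivMod
  open import Data.Nat.Divisibility as Div using (_∣_)
  open import Data.Nat.Coprimality using (coprime-divisor; coprime-/gcd)
  open import Data.Nat.GCD using (gcd; gcd[m,n]∣m; gcd[m,n]∣n; gcd[m,n]≡0⇒m≡0)
  open import Data.Nat.Primality using (prime⇒nonTrivial; prime⇒nonZero)
  open Arithmetic
  open CyclotomicClasses S using (toℕ-pt; s%n)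

  private instance
    n≢0 : NonZero n
    n≢0 = nz

  q≥2 : 2 ≤ q
  q≥2 with q-pp
  ... | p , k , p-prime , k>0 , q≡pᵏ = begin
      2       ≤⟨ ℕ.nonTrivial⇒n>1 p ⦃ prime⇒nonTrivial p-prime ⦄ ⟩
      p       ≡⟨ sym (*-identityʳ p) ⟩
      p ^ 1   ≤⟨ ^-monoʳ-≤ p ⦃ prime⇒nonZero p-prime ⦄ k>0 ⟩
      p ^ k   ≡⟨ sym q≡pᵏ ⟩
      q       ∎
    where open ≤-Reasoning

  instance
    q≢0 : NonZero q
    q≢0 = ℕ.>-nonZero (<-trans (s≤s z≤n) q≥2)

  q^ℓ≥2 : ∀ i → 2 ≤ q ^ ℓ i
  q^ℓ≥2 i = ≤-trans q≥2 (≤-trans (≤-reflexive (sym (*-identityʳ q))) (^-monoʳ-≤ q (ℓ-pos i)))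

  gcd≢0 : ∀ i → NonZero (gcd n (toℕ (s i)))
  gcd≢0 i = ℕ.≢-nonZero (λ e → ℕ.≢-nonZero⁻¹ n (gcd[m,n]≡0⇒m≡0 e))

  private
    module _ (i : Fin m) where
      instance _ = gcd≢0 i
      d  = gcd n (toℕ (s i))
      n′ = n / d
      s′ = toℕ (s i) / d
      Qℓ = q ^ ℓ i ∸ 1

      n≡dn′ : d * n′ ≡ n
      n≡dn′ = m*[n/m]≡n (gcd[m,n]∣m n (toℕ (s i)))

      s≡ds′ : d * s′ ≡ toℕ (s i)
      s≡ds′ = m*[n/m]≡n (gcd[m,n]∣n n (toℕ (s i)))

      -- q^ℓ_i s_i ≡ s_i (mod n)
      n∣Qℓ·s : n ∣ Qℓ * toℕ (s i)
      n∣Qℓ·s = subst (n ∣_) (trans (cong (q ^ ℓ i * toℕ (s i) ∸_) (sym (*-identityˡ (toℕ (s i)))))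
                                   (sym (*-distribʳ-∸ (toℕ (s i)) (q ^ ℓ i) 1)))
                     (%-≡⇒∣∸ _ _ (trans (sym (toℕ-pt i (ℓ i))) (trans (cong toℕ (ℓ-period i)) (sym (s%n i)))))

      -- dividing by d, and n′ is coprime to s′
      n′∣Qℓ : n′ ∣ Qℓ
      n′∣Qℓ = coprime-divisor (coprime-/gcd n (toℕ (s i)))
                (subst (n′ ∣_) (*-comm Qℓ s′) (Div.*-cancelˡ-∣ d (subst₂ _∣_ (sym n≡dn′) d·Qℓs′ n∣Qℓ·s)))
        where
        d·Qℓs′ : Qℓ * toℕ (s i) ≡ d * (Qℓ * s′)
        d·Qℓs′ = begin
          Qℓ * toℕ (s i)  ≡⟨ cong (Qℓ *_) (sym s≡ds′) ⟩
          Qℓ * (d * s′)   ≡⟨ sym (*-assoc Qℓ d s′) ⟩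
          Qℓ * d * s′     ≡⟨ cong (_* s′) (*-comm Qℓ d) ⟩
          d * Qℓ * s′     ≡⟨ *-assoc d Qℓ s′ ⟩
          d * (Qℓ * s′)   ∎
          where open ≡-Reasoning

      c = Div.quotient n′∣Qℓ

      Qℓ≡cn′ : Qℓ ≡ c * n′
      Qℓ≡cn′ = Div._∣_.equality n′∣Qℓ

      D≡c : D i ≡ c
      D≡c = begin
        D i                 ≡⟨ div'≡ (Qℓ * d) n ⟩
        Qℓ * d / n          ≡⟨ cong (λ t → t * d / n) Qℓ≡cn′ ⟩
        c * n′ * d / n      ≡⟨ cong (_/ n) (trans (*-assoc c n′ d) (cong (c *_) (trans (*-comm n′ d) n≡dn′))) ⟩
        c * n / n           ≡⟨ m*n/n≡m c n ⟩
        c                   ∎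
        where open ≡-Reasoning

      ni≡n′ : ni i ≡ n′
      ni≡n′ = div'≡ n d

  D·ni≡q^ℓ-1 : ∀ i → D i * ni i ≡ q ^ ℓ i ∸ 1
  D·ni≡q^ℓ-1 i = trans (cong₂ _*_ (D≡c i) (ni≡n′ i)) (sym (Qℓ≡cn′ i))

  ni>0 : ∀ i → 0 < ni i
  ni>0 i = subst (0 <_) (sym (ni≡n′ i))
                 (n≢0⇒n>0 (λ n′≡0 → ℕ.≢-nonZero⁻¹ n (trans (sym (n≡dn′ i)) (trans (cong (gcd n (toℕ (s i)) *_) n′≡0) (*-zeroʳ (gcd n (toℕ (s i))))))))

  D>0 : ∀ i → 0 < D i
  D>0 i = n≢0⇒n>0 (λ D≡0 → <⇒≢ (≤-trans (s≤s z≤n) (∸-monoˡ-≤ 1 (q^ℓ≥2 i)))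
                                 (sym (trans (sym (D·ni≡q^ℓ-1 i)) (cong (_* ni i) D≡0))))


-- Since (ω^z)^n = 1 this is a
-- ring homomorphism on 𝒬 = 𝔽_q[X]/(X^n − 1), and since the ω^z (z < n) are n distinct
-- points, α is determined by its values (root bound).
module RootsOfUnity (S : Setup) where
  open SetupDefs S public
  open import Data.Nat using (_<_; _∸_)
  open import Function.Bundles using (Inverse; Injection)
  open import Function.Properties.Inverse using (↔⇒↣; ↔-sym)
  open import Relation.Binary using (tri<; tri≈; tri>)
  module FF = FieldFacts 𝔽.field′
  module KF = FieldFacts K
  module Hι = PolyEval 𝔽.field′ K ι ι-hom
  module RK = RootBound K

  toFin : F → Fin q
  toFin = Inverse.to 𝔽.enumeration

  fromFin : Fin q → F
  fromFin = Inverse.from 𝔽.enumeration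

  toFin-injective : ∀ {x y} → toFin x ≡ toFin y → x ≡ y
  toFin-injective = Injection.injective (↔⇒↣ 𝔽.enumeration)

  fromFin-injective : ∀ {x y} → fromFin x ≡ fromFin y → x ≡ y
  fromFin-injective = Injection.injective (↔⇒↣ (↔-sym 𝔽.enumeration))

  -- equality in 𝔽_q is decidable, so the embedding ι : 𝔽_q → K is injective
  _≟F_ : (x y : F) → Dec (x ≡ y)
  x ≟F y with toFin x FinP.≟ toFin y
  ... | yes e = yes (toFin-injective e)
  ... | no ne = no (λ e → ne (cong toFin e))

  ι-injective : ∀ {x y} → ι x ≡ ι y → x ≡ y
  ι-injective = Hι.injective _≟F_

  ι≡0 : ∀ {x} → ι x ≡ KF.0# → x ≡ FF.0#
  ι≡0 e = ι-injective (trans e (sym Hι.pres-0))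

  ω^ : ℕ → KF.Carrier
  ω^ z = KF.pow ω z

  ω^-root : ∀ z → KF.pow (ω^ z) n ≡ KF.1#
  ω^-root z = begin
      KF.pow (KF.pow ω z) n   ≡⟨ sym (KF.pow-* ω z n) ⟩
      KF.pow ω (z ℕ.* n)      ≡⟨ cong (KF.pow ω) (ℕP.*-comm z n) ⟩
      KF.pow ω (n ℕ.* z)      ≡⟨ KF.pow-* ω n z ⟩
      KF.pow (KF.pow ω n) z   ≡⟨ cong (λ t → KF.pow t z) ω-root ⟩
      KF.pow KF.1# z          ≡⟨ KF.pow-1# z ⟩
      KF.1#                   ∎
    where open ≡-Reasoning

  ev : ℕ → 𝒬 → KF.Carrier
  ev z α = Hι.evalV {n} (ω^ z) α

  ev-toQ : ∀ z p → ev z (toQ p) ≡ Hι.eval p (ω^ z)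
  ev-toQ z []       = Hι.evalV-0 {n} (ω^ z)
  ev-toQ z (c ∷ cs) = begin
      ev z (toQ (c ∷ cs))
        ≡⟨ Hι.evalV-+ {n} (ω^ z) const-c (λ i → toQ cs (red (toℕ i ℕ.+ (n ∸ 1)))) ⟩
      Hι.evalV {n} (ω^ z) const-c KF.+ᶠ Hι.evalV {n} (ω^ z) (λ i → toQ cs (red (toℕ i ℕ.+ (n ∸ 1))))
        ≡⟨ cong₂ KF._+ᶠ_ (evalV-δ n nz) (Hι.evalV-rotate n nz (ω^ z) (ω^-root z) (toQ cs)) ⟩
      ι c KF.+ᶠ ω^ z KF.*ᶠ ev z (toQ cs)
        ≡⟨ cong (λ t → ι c KF.+ᶠ ω^ z KF.*ᶠ t) (ev-toQ z cs) ⟩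
      Hι.eval (c ∷ cs) (ω^ z) ∎
    where
    open ≡-Reasoning
    const-c : Fin n → F
    const-c i = if toℕ i ℕ.≡ᵇ 0 then c else FF.0#
    evalV-δ : ∀ N (nzN : ℕ.NonZero N) → Hι.evalV {N} (ω^ z) (λ i → if toℕ i ℕ.≡ᵇ 0 then c else FF.0#) ≡ ι c
    evalV-δ (suc N) _ = Hι.evalV-δ {N} (ω^ z) c

  ev-mulQ : ∀ z a b → ev z (mulQ a b) ≡ ev z a KF.*ᶠ ev z b
  ev-mulQ z a b = trans (ev-toQ z (Poly.mulP 𝔽.field′ (tabulate a) (tabulate b))) (Hι.eval-mul (tabulate a) (tabulate b) (ω^ z))

  ev-subQ : ∀ z a b → ev z (subQ a b) ≡ ev z a KF.-ᶠ ev z b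
  ev-subQ z a b = trans (Hι.evalV-+ {n} (ω^ z) a (λ i → FF.-ᶠ b i)) (cong (ev z a KF.+ᶠ_) (Hι.evalV-neg {n} (ω^ z) b))

  eval-1 : ∀ x → Hι.eval (𝔽.1# ∷ []) x ≡ KF.1#
  eval-1 x = trans (cong₂ KF._+ᶠ_ Hι.pres-1 (KF.zeroʳ x)) (KF.+-identityʳ _)

  ev-powQ : ∀ z a k → ev z (powQ a k) ≡ KF.pow (ev z a) k
  ev-powQ z a zero    = trans (ev-toQ z (𝔽.1# ∷ [])) (eval-1 _)
  ev-powQ z a (suc k) = trans (ev-mulQ z a (powQ a k)) (cong (ev z a KF.*ᶠ_) (ev-powQ z a k))

  ev-XQ : ∀ z → ev z XQ ≡ ω^ z
  ev-XQ z = begin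
      ev z XQ                                    ≡⟨ ev-toQ z (𝔽.0# ∷ 𝔽.1# ∷ []) ⟩
      ι 𝔽.0# KF.+ᶠ ω^ z KF.*ᶠ Hι.eval (𝔽.1# ∷ []) (ω^ z) ≡⟨ cong₂ (λ a b → a KF.+ᶠ ω^ z KF.*ᶠ b) Hι.pres-0 (eval-1 (ω^ z)) ⟩
      KF.0# KF.+ᶠ ω^ z KF.*ᶠ KF.1#               ≡⟨ trans (KF.+-identityˡ _) (KF.*-identityʳ _) ⟩
      ω^ z                                       ∎
    where open ≡-Reasoning

  -- ω ≠ 0 since ω^n = 1
  ω≢0 : ω ≢ KF.0#
  ω≢0 ω≡0 = KF.0≢1 (begin
      KF.0#                                ≡⟨ sym (KF.zeroˡ _) ⟩
      KF.0# KF.*ᶠ KF.pow ω (n ∸ 1)         ≡⟨ cong (KF._*ᶠ KF.pow ω (n ∸ 1)) (sym ω≡0) ⟩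
      KF.pow ω (suc (n ∸ 1))               ≡⟨ cong (KF.pow ω) (ℕP.suc-pred n ⦃ nz ⦄) ⟩
      KF.pow ω n                           ≡⟨ ω-root ⟩
      KF.1#                                ∎)
    where open ≡-Reasoning

  ω^-distinct : ∀ a b → a < b → b < n → ω^ a ≢ ω^ b
  ω^-distinct a b a<b b<n e = ω-primitive (b ∸ a) (ℕP.m<n⇒0<n∸m a<b) (ℕP.≤-<-trans (ℕP.m∸n≤m b a) b<n)
                                (KF.pow-cancel a (b ∸ a) ω≢0 (trans e (cong ω^ (sym (ℕP.m+[n∸m]≡n (ℕP.<⇒≤ a<b))))))

  ω^-injective : ∀ a b → a < n → b < n → ω^ a ≡ ω^ b → a ≡ b
  ω^-injective a b a<n b<n e with ℕP.<-cmp a b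
  ... | tri< a<b _ _ = ⊥-elim (ω^-distinct a b a<b b<n e)
  ... | tri≈ _ a≡b _ = a≡b
  ... | tri> _ _ a>b = ⊥-elim (ω^-distinct b a a>b a<n (sym e))

  ev-zero : ∀ α → (∀ (w : Fin n) → ev (toℕ w) α ≡ KF.0#) → ∀ i → α i ≡ FF.0#
  ev-zero α vanish i = ι≡0 (AllP.tabulate⁻ (AllP.map⁻ allZero) i)
    where
    allZero : RK.AllZero (map ι (tabulate α))
    allZero = RK.rootBound n (λ w → ω^ (toℕ w))
                (λ v w e → FinP.toℕ-injective (ω^-injective _ _ (FinP.toℕ<n v) (FinP.toℕ<n w) e))
                (map ι (tabulate α)) (ℕP.≤-reflexive (trans (ListP.length-map ι (tabulate α)) (ListP.length-tabulate α)))
                (λ w → trans (sym (eval-map 𝔽.field′ K ι ι-hom (tabulate α) (ω^ (toℕ w)))) (vanish w))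

  ev-ext : ∀ a b → (∀ (w : Fin n) → ev (toℕ w) a ≡ ev (toℕ w) b) → a ≈Q b
  ev-ext a b same i = FF.sub≡0 _ _ (ev-zero (subQ a b) (λ w → begin
      ev (toℕ w) (subQ a b)                ≡⟨ ev-subQ (toℕ w) a b ⟩
      ev (toℕ w) a KF.-ᶠ ev (toℕ w) b      ≡⟨ cong (KF._-ᶠ ev (toℕ w) b) (same w) ⟩
      ev (toℕ w) b KF.-ᶠ ev (toℕ w) b      ≡⟨ KF.-‿inverseʳ _ ⟩
      KF.0#                                ∎) i)
    where open ≡-Reasoning


-- P_i = ∏_{j<ℓ_i} (X − ω^(q^j s_i)) is monic of degree ℓ_i with the distinct roots
-- ω^(pt i j).  Hence P_i ∣ α iff α vanishes at these roots, and congruence modulo P_i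
-- means equal values on S_i; the remainder of α modulo P_i is determined by these values.
module DivisibilityByP (S : Setup) where
  open RootsOfUnity S public
  open import Data.Nat using (_<_; _≤_)
  open import Data.List.Membership.Propositional using () renaming (_∈_ to _∈ₗ_)
  open import Data.List.Membership.Propositional.Properties using (∈-upTo⁺)
  open import Data.List.Relation.Unary.Any using (here; there)
  open CyclotomicClasses S using (pt-injective)
  module MK = MonicProduct K
  module PK = Poly K
  module HK = PolyEval K K id (idHom K)

  -- the root ω^(q^j s_i) of P_i, negated: the linear factor is  −root + X
  negRoot : Fin m → ℕ → KF.Carrier
  negRoot i j = KF.-ᶠ ω^ (toℕ (pt i j))

  MonicShape : Fin m → Set
  MonicShape i = Σ (List F) λ low → Σ F λ d → (P i ≡ low ++ d ∷ []) × (length low ≡ ℓ i) × (d ≡ 𝔽.1#)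

  P-shape : ∀ i → MonicShape i
  P-shape i with subst (λ k → MK.Monic k (prodK i)) (ListP.length-upTo (ℓ i)) (MK.monic-product (negRoot i) (upTo (ℓ i)))
  ... | lowK , c , prod≡ , len , c≡1 with map-snoc⁻ ι (P i) lowK c (trans (P-def i) prod≡)
  ... | low , d , P≡ , map≡ , ιd≡c =
        low , d , P≡ , trans (sym (ListP.length-map ι low)) (trans (cong length map≡) len) ,
        ι-injective (trans ιd≡c (trans c≡1 (sym Hι.pres-1)))

  Plow : Fin m → List F
  Plow i = proj₁ (P-shape i)

  Plow-length : ∀ i → length (Plow i) ≡ ℓ i
  Plow-length i = proj₁ (proj₂ (proj₂ (proj₂ (P-shape i))))

  eval-P : ∀ i x → Hι.eval (P i) x ≡ Hι.eval (Plow i) x KF.+ᶠ KF.pow x (ℓ i)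
  eval-P i x = shape⇒eval (P-shape i)
    where
    open ≡-Reasoning
    shape⇒eval : (sh : MonicShape i) → Hι.eval (P i) x ≡ Hι.eval (proj₁ sh) x KF.+ᶠ KF.pow x (ℓ i)
    shape⇒eval (low , d , P≡ , len , d≡1) = begin
        Hι.eval (P i) x                                    ≡⟨ cong (λ l → Hι.eval l x) P≡ ⟩
        Hι.eval (low ++ d ∷ []) x                          ≡⟨ Hι.eval-snoc low d x ⟩
        Hι.eval low x KF.+ᶠ ι d KF.*ᶠ KF.pow x (length low) ≡⟨ cong₂ (λ a k → Hι.eval low x KF.+ᶠ a KF.*ᶠ KF.pow x k)
                                                                    (trans (cong ι d≡1) Hι.pres-1) len ⟩
        Hι.eval low x KF.+ᶠ KF.1# KF.*ᶠ KF.pow x (ℓ i)     ≡⟨ cong (Hι.eval low x KF.+ᶠ_) (KF.*-identityˡ _) ⟩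
        Hι.eval low x KF.+ᶠ KF.pow x (ℓ i)                 ∎

  product-root : ∀ i (js : List ℕ) j → j ∈ₗ js →
                 HK.eval (foldr PK.mulP (KF.1# ∷ []) (map (λ j → negRoot i j ∷ KF.1# ∷ []) js)) (ω^ (toℕ (pt i j))) ≡ KF.0#
  product-root i (j ∷ js) .j (here refl) =
    trans (HK.eval-mul (negRoot i j ∷ KF.1# ∷ []) rest x) (trans (cong (KF._*ᶠ HK.eval rest x) factor≡0) (KF.zeroˡ _))
    where
    x    = ω^ (toℕ (pt i j))
    rest = foldr PK.mulP (KF.1# ∷ []) (map (λ j → negRoot i j ∷ KF.1# ∷ []) js)
    factor≡0 : HK.eval (negRoot i j ∷ KF.1# ∷ []) x ≡ KF.0#
    factor≡0 = trans (cong (negRoot i j KF.+ᶠ_) (KF.solve 1 (λ x → x KF.:* (KF.con 1 KF.:+ x KF.:* KF.con 0) KF.:= x) refl x))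
                     (KF.-‿inverseˡ x)
  product-root i (j′ ∷ js) j (there j∈) =
    trans (HK.eval-mul (negRoot i j′ ∷ KF.1# ∷ []) rest x)
          (trans (cong (HK.eval (negRoot i j′ ∷ KF.1# ∷ []) x KF.*ᶠ_) (product-root i js j j∈)) (KF.zeroʳ _))
    where
    x    = ω^ (toℕ (pt i j))
    rest = foldr PK.mulP (KF.1# ∷ []) (map (λ j → negRoot i j ∷ KF.1# ∷ []) js)

  ev-P-root : ∀ i j → j < ℓ i → ev (toℕ (pt i j)) (Pq i) ≡ KF.0#
  ev-P-root i j j<ℓ = begin
      ev z (Pq i)                  ≡⟨ ev-toQ z (P i) ⟩
      Hι.eval (P i) (ω^ z)         ≡⟨ eval-map 𝔽.field′ K ι ι-hom (P i) (ω^ z) ⟩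
      HK.eval (map ι (P i)) (ω^ z) ≡⟨ cong (λ l → HK.eval l (ω^ z)) (P-def i) ⟩
      HK.eval (prodK i) (ω^ z)     ≡⟨ product-root i (upTo (ℓ i)) j (∈-upTo⁺ j<ℓ) ⟩
      KF.0#                        ∎
    where open ≡-Reasoning
          z = toℕ (pt i j)

  div⇒ev : ∀ i α → Pq i ∣Q α → ∀ j → j < ℓ i → ev (toℕ (pt i j)) α ≡ KF.0#
  div⇒ev i α (β , Pβ≈α) j j<ℓ = begin
      ev z α                         ≡⟨ cong (λ l → Hι.eval l (ω^ z)) (ListP.tabulate-cong (λ k → sym (Pβ≈α k))) ⟩
      ev z (mulQ (Pq i) β)           ≡⟨ ev-mulQ z (Pq i) β ⟩
      ev z (Pq i) KF.*ᶠ ev z β       ≡⟨ cong (KF._*ᶠ ev z β) (ev-P-root i j j<ℓ) ⟩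
      KF.0# KF.*ᶠ ev z β             ≡⟨ KF.zeroˡ _ ⟩
      KF.0#                          ∎
    where open ≡-Reasoning
          z = toℕ (pt i j)

  module Div (i : Fin m) = MonicDivision 𝔽.field′ K ι ι-hom (Plow i)

  quo rem : Fin m → 𝒬 → List F
  quo i α = Div.quotient  i (tabulate α)
  rem i α = Div.remainder i (tabulate α)

  ℓ>0 : ∀ i → 0 < length (Plow i)
  ℓ>0 i = subst (0 <_) (sym (Plow-length i)) (ℓ-pos i)

  rem-length : ∀ i α → length (rem i α) ≡ ℓ i
  rem-length i α = trans (Div.remainder-length i (ℓ>0 i) (tabulate α)) (Plow-length i)

  divide-eval : ∀ i α x → Hι.eval (tabulate α) x ≡ Hι.eval (P i) x KF.*ᶠ Hι.eval (quo i α) x KF.+ᶠ Hι.eval (rem i α) x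
  divide-eval i α x = trans (Div.divide-eval i (ℓ>0 i) (tabulate α) x)
    (cong (λ E → E KF.*ᶠ Hι.eval (quo i α) x KF.+ᶠ Hι.eval (rem i α) x)
          (trans (cong (λ k → Hι.eval (Plow i) x KF.+ᶠ KF.pow x k) (Plow-length i)) (sym (eval-P i x))))

  ev-root≡rem : ∀ i α j → j < ℓ i → ev (toℕ (pt i j)) α ≡ Hι.eval (rem i α) (ω^ (toℕ (pt i j)))
  ev-root≡rem i α j j<ℓ = begin
      ev z α                                                     ≡⟨ divide-eval i α x ⟩
      Hι.eval (P i) x KF.*ᶠ Hι.eval (quo i α) x KF.+ᶠ Hι.eval (rem i α) x
        ≡⟨ cong (λ t → t KF.*ᶠ Hι.eval (quo i α) x KF.+ᶠ Hι.eval (rem i α) x) (trans (sym (ev-toQ z (P i))) (ev-P-root i j j<ℓ)) ⟩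
      KF.0# KF.*ᶠ Hι.eval (quo i α) x KF.+ᶠ Hι.eval (rem i α) x  ≡⟨ cong (KF._+ᶠ Hι.eval (rem i α) x) (KF.zeroˡ _) ⟩
      KF.0# KF.+ᶠ Hι.eval (rem i α) x                           ≡⟨ KF.+-identityˡ _ ⟩
      Hι.eval (rem i α) x                                       ∎
    where open ≡-Reasoning
          z = toℕ (pt i j)
          x = ω^ z

  AllZero : List F → Set
  AllZero = All (_≡ FF.0#)

  -- a remainder (ℓ_i coefficients) vanishing at the ℓ_i distinct roots of P_i is zero
  rem-zero : ∀ i α → (∀ j → j < ℓ i → ev (toℕ (pt i j)) α ≡ KF.0#) → AllZero (rem i α)
  rem-zero i α vanish = All.map ι≡0 (AllP.map⁻ allZero)
    where
    roots-distinct : ∀ j j′ → ω^ (toℕ (pt i (toℕ j))) ≡ ω^ (toℕ (pt i (toℕ j′))) → j ≡ j′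
    roots-distinct j j′ e = FinP.toℕ-injective (pt-injective i _ _ (FinP.toℕ<n j) (FinP.toℕ<n j′)
                              (FinP.toℕ-injective (ω^-injective _ _ (FinP.toℕ<n (pt i (toℕ j))) (FinP.toℕ<n (pt i (toℕ j′))) e)))
    allZero : RK.AllZero (map ι (rem i α))
    allZero = RK.rootBound (ℓ i) (λ j → ω^ (toℕ (pt i (toℕ j)))) roots-distinct
                (map ι (rem i α)) (ℕP.≤-reflexive (trans (ListP.length-map ι (rem i α)) (rem-length i α)))
                (λ j → trans (sym (eval-map 𝔽.field′ K ι ι-hom (rem i α) _))
                             (trans (sym (ev-root≡rem i α (toℕ j) (FinP.toℕ<n j))) (vanish (toℕ j) (FinP.toℕ<n j))))

  -- zero remainder gives an explicit cofactor; equality is checked by evaluation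
  remZero⇒div : ∀ i α → AllZero (rem i α) → Pq i ∣Q α
  remZero⇒div i α rem≡0 = toQ (quo i α) , ev-ext _ _ (λ w → let x = ω^ (toℕ w) in begin
      ev (toℕ w) (mulQ (Pq i) (toQ (quo i α)))                   ≡⟨ ev-mulQ (toℕ w) (Pq i) (toQ (quo i α)) ⟩
      ev (toℕ w) (Pq i) KF.*ᶠ ev (toℕ w) (toQ (quo i α))          ≡⟨ cong₂ KF._*ᶠ_ (ev-toQ (toℕ w) (P i)) (ev-toQ (toℕ w) (quo i α)) ⟩
      Hι.eval (P i) x KF.*ᶠ Hι.eval (quo i α) x                  ≡⟨ sym (KF.+-identityʳ _) ⟩
      Hι.eval (P i) x KF.*ᶠ Hι.eval (quo i α) x KF.+ᶠ KF.0#      ≡⟨ cong (Hι.eval (P i) x KF.*ᶠ Hι.eval (quo i α) x KF.+ᶠ_) (sym (Hι.eval-zeros (rem i α) x rem≡0)) ⟩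
      Hι.eval (P i) x KF.*ᶠ Hι.eval (quo i α) x KF.+ᶠ Hι.eval (rem i α) x ≡⟨ sym (divide-eval i α x) ⟩
      ev (toℕ w) α                                               ∎)
    where open ≡-Reasoning

  ev⇒div : ∀ i α → (∀ j → j < ℓ i → ev (toℕ (pt i j)) α ≡ KF.0#) → Pq i ∣Q α
  ev⇒div i α vanish = remZero⇒div i α (rem-zero i α vanish)

  -- divisibility by P_i is decidable: test whether the remainder is zero
  div? : ∀ i α → Dec (Pq i ∣Q α)
  div? i α with All.all? (λ c → c ≟F FF.0#) (rem i α)
  ... | yes rem≡0 = yes (remZero⇒div i α rem≡0)
  ... | no  rem≢0 = no (λ d → rem≢0 (rem-zero i α (div⇒ev i α d)))

  AgreeOn : Fin m → 𝒬 → 𝒬 → Set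
  AgreeOn i α β = ∀ j → j < ℓ i → ev (toℕ (pt i j)) α ≡ ev (toℕ (pt i j)) β

  cong⇒agree : ∀ i α β → Cong (Pq i) α β → AgreeOn i α β
  cong⇒agree i α β c j j<ℓ = KF.sub≡0 _ _ (trans (sym (ev-subQ (toℕ (pt i j)) α β)) (div⇒ev i (subQ α β) c j j<ℓ))

  agree⇒cong : ∀ i α β → AgreeOn i α β → Cong (Pq i) α β
  agree⇒cong i α β same = ev⇒div i (subQ α β) (λ j j<ℓ →
    trans (ev-subQ (toℕ (pt i j)) α β) (trans (cong (KF._-ᶠ ev (toℕ (pt i j)) β) (same j j<ℓ)) (KF.-‿inverseʳ _)))

  cong? : ∀ i α β → Dec (Cong (Pq i) α β)
  cong? i α β = div? i (subQ α β)


-- Discrete logarithms to base g_i exist, are unique, and are smaller than q^ℓ_i − 1.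
-- The bound comes from an exponent 0 < d < q^ℓ_i with g_i^d ≡ 1 on S_i, found by
-- pigeonhole on the (never zero) remainders of g_i^k modulo P_i.
module DiscreteLog (S : Setup) where
  open DivisibilityByP S public
  open import Data.Nat using (_+_; _*_; _^_; _<_; _≤_; _∸_; z≤n; s≤s)
  open import Relation.Binary using (tri<; tri≈; tri>)
  open ClassNumbers S using (q≢0; D>0)
  open Arithmetic using (divmod-unique; divmod-bound)

  code : List F → ℕ
  code []       = 0
  code (c ∷ cs) = code cs * q + toℕ (toFin c)

  code< : ∀ cs → code cs < q ^ length cs
  code< []       = s≤s z≤n
  code< (c ∷ cs) = subst (code (c ∷ cs) <_) (ℕP.*-comm (q ^ length cs) q)
                         (divmod-bound (code cs) (q ^ length cs) (toℕ (toFin c)) q (code< cs) (FinP.toℕ<n (toFin c)))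

  code-injective : ∀ xs ys → length xs ≡ length ys → code xs ≡ code ys → xs ≡ ys
  code-injective []       []       _   _ = refl
  code-injective (c ∷ xs) (d ∷ ys) len e
    with divmod-unique _ _ _ _ q (FinP.toℕ<n (toFin c)) (FinP.toℕ<n (toFin d)) e
  ... | same-high , same-low = cong₂ _∷_ (toFin-injective (FinP.toℕ-injective same-low))
                                         (code-injective xs ys (ℕP.suc-injective len) same-high)

  γ : Fin m → ℕ → KF.Carrier
  γ i j = ev (toℕ (pt i j)) (g i)

  -- γ^D_i = ω^(q^j s_i) ≠ 0, as X_i = g_i^D_i
  γ≢0 : ∀ i j → j < ℓ i → γ i j ≢ KF.0#
  γ≢0 i j j<ℓ γ≡0 = KF.pow≢0 (toℕ (pt i j)) ω≢0 (begin
      ω^ (toℕ (pt i j))                 ≡⟨ sym (ev-XQ (toℕ (pt i j))) ⟩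
      ev (toℕ (pt i j)) XQ              ≡⟨ cong⇒agree i XQ (powQ (g i) (D i)) (g-X i) j j<ℓ ⟩
      ev (toℕ (pt i j)) (powQ (g i) (D i)) ≡⟨ ev-powQ (toℕ (pt i j)) (g i) (D i) ⟩
      KF.pow (γ i j) (D i)              ≡⟨ cong (λ t → KF.pow t (D i)) γ≡0 ⟩
      KF.pow KF.0# (D i)                ≡⟨ pow0 (D i) (D>0 i) ⟩
      KF.0#                             ∎)
    where
    open ≡-Reasoning
    pow0 : ∀ k → 0 < k → KF.pow KF.0# k ≡ KF.0#
    pow0 (suc k) _ = KF.zeroˡ _

  powRem : Fin m → ℕ → List F
  powRem i k = rem i (powQ (g i) k)

  -- g_i^k is a unit modulo P_i, so its remainder never vanishes
  powRem-nonzero : ∀ i k → ¬ AllZero (powRem i k)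
  powRem-nonzero i k rem≡0 = KF.pow≢0 k (γ≢0 i 0 (ℓ-pos i)) (begin
      KF.pow (γ i 0) k                         ≡⟨ sym (ev-powQ (toℕ (pt i 0)) (g i) k) ⟩
      ev (toℕ (pt i 0)) (powQ (g i) k)         ≡⟨ div⇒ev i _ (remZero⇒div i _ rem≡0) 0 (ℓ-pos i) ⟩
      KF.0#                                    ∎)
    where open ≡-Reasoning

  powRem-equal : ∀ i a b → powRem i a ≡ powRem i b → ∀ j → j < ℓ i → KF.pow (γ i j) a ≡ KF.pow (γ i j) b
  powRem-equal i a b same j j<ℓ = begin
      KF.pow (γ i j) a                               ≡⟨ sym (ev-powQ (toℕ (pt i j)) (g i) a) ⟩
      ev (toℕ (pt i j)) (powQ (g i) a)               ≡⟨ ev-root≡rem i _ j j<ℓ ⟩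
      Hι.eval (powRem i a) (ω^ (toℕ (pt i j)))       ≡⟨ cong (λ l → Hι.eval l (ω^ (toℕ (pt i j)))) same ⟩
      Hι.eval (powRem i b) (ω^ (toℕ (pt i j)))       ≡⟨ sym (ev-root≡rem i _ j j<ℓ) ⟩
      ev (toℕ (pt i j)) (powQ (g i) b)               ≡⟨ ev-powQ (toℕ (pt i j)) (g i) b ⟩
      KF.pow (γ i j) b                               ∎
    where open ≡-Reasoning

  order-bound : ∀ i → Σ ℕ λ d → 0 < d × d < q ^ ℓ i × (∀ j → j < ℓ i → KF.pow (γ i j) d ≡ KF.1#)
  order-bound i = fromCollision (Finite.pigeonhole-avoiding codeOf zeroCode avoids)
    where
    N′ = q ^ ℓ i ∸ 1
    q^ℓ≡ : q ^ ℓ i ≡ suc N′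
    q^ℓ≡ = sym (ℕP.suc-pred (q ^ ℓ i) ⦃ ℕP.m^n≢0 q (ℓ i) ⦄)
    code<q^ℓ : ∀ cs → length cs ≡ ℓ i → code cs < suc N′
    code<q^ℓ cs len = subst (code cs <_) (trans (cong (q ^_) len) q^ℓ≡) (code< cs)
    codeOf : Fin (suc N′) → Fin (suc N′)
    codeOf t = Fin.fromℕ< (code<q^ℓ (powRem i (toℕ t)) (rem-length i _))
    zeros : List F
    zeros = replicate (ℓ i) FF.0#
    zeroCode : Fin (suc N′)
    zeroCode = Fin.fromℕ< (code<q^ℓ zeros (ListP.length-replicate (ℓ i)))
    toℕ-codeOf : ∀ t → toℕ (codeOf t) ≡ code (powRem i (toℕ t))
    toℕ-codeOf t = FinP.toℕ-fromℕ< _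
    codeOf-injective : ∀ a b → codeOf a ≡ codeOf b → powRem i (toℕ a) ≡ powRem i (toℕ b)
    codeOf-injective a b e = code-injective _ _ (trans (rem-length i _) (sym (rem-length i _)))
                               (trans (sym (toℕ-codeOf a)) (trans (cong toℕ e) (toℕ-codeOf b)))
    avoids : ∀ t → codeOf t ≢ zeroCode
    avoids t e = powRem-nonzero i (toℕ t) (subst AllZero (sym powRem≡zeros) (AllP.replicate⁺ (ℓ i) refl))
      where
      powRem≡zeros : powRem i (toℕ t) ≡ zeros
      powRem≡zeros = code-injective _ _ (trans (rem-length i _) (sym (ListP.length-replicate (ℓ i))))
                       (trans (sym (toℕ-codeOf t)) (trans (cong toℕ e) (FinP.toℕ-fromℕ< _)))
    fromCollision : (Σ (Fin (suc N′)) λ a → Σ (Fin (suc N′)) λ b → a Fin.< b × codeOf a ≡ codeOf b) →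
                    Σ ℕ λ d → 0 < d × d < q ^ ℓ i × (∀ j → j < ℓ i → KF.pow (γ i j) d ≡ KF.1#)
    fromCollision (a , b , a<b , e) = toℕ b ∸ toℕ a , ℕP.m<n⇒0<n∸m a<b , d<q^ℓ , γᵈ≡1
      where
      d<q^ℓ : toℕ b ∸ toℕ a < q ^ ℓ i
      d<q^ℓ = ℕP.≤-<-trans (ℕP.m∸n≤m (toℕ b) (toℕ a)) (subst (toℕ b <_) (sym q^ℓ≡) (FinP.toℕ<n b))
      γᵈ≡1 : ∀ j → j < ℓ i → KF.pow (γ i j) (toℕ b ∸ toℕ a) ≡ KF.1#
      γᵈ≡1 j j<ℓ = KF.pow-cancel (toℕ a) _ (γ≢0 i j j<ℓ)
        (trans (powRem-equal i (toℕ a) (toℕ b) (codeOf-injective a b e) j j<ℓ)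
               (cong (KF.pow (γ i j)) (sym (ℕP.m+[n∸m]≡n (ℕP.<⇒≤ a<b)))))

  log-exists : ∀ i α → ¬ (Pq i ∣Q α) → Σ ℕ (IsLog i α)
  log-exists i α ¬P∣α = Finite.least (λ k → Cong (Pq i) α (powQ (g i) k)) (λ k → cong? i α (powQ (g i) k))
                                      (proj₁ (g-gen i α ¬P∣α)) (proj₂ (g-gen i α ¬P∣α))

  log-unique : ∀ i α k k′ → IsLog i α k → IsLog i α k′ → k ≡ k′
  log-unique i α k k′ (c , below) (c′ , below′) with ℕP.<-cmp k k′
  ... | tri< k<k′ _ _ = ⊥-elim (below′ k k<k′ c)
  ... | tri≈ _ k≡k′ _ = k≡k′
  ... | tri> _ _ k>k′ = ⊥-elim (below k′ k>k′ c′)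

  log<period : ∀ i α k d → 0 < d → (∀ j → j < ℓ i → KF.pow (γ i j) d ≡ KF.1#) → IsLog i α k → k < d
  log<period i α k d d>0 period (c , below) with k ℕ.<? d
  ... | yes k<d = k<d
  ... | no  k≮d = ⊥-elim (below (k ∸ d) (ℕP.∸-monoʳ-< d>0 d≤k) (agree⇒cong i α (powQ (g i) (k ∸ d)) shifted))
    where
    d≤k : d ℕ.≤ k
    d≤k = ℕP.≮⇒≥ k≮d
    shifted : AgreeOn i α (powQ (g i) (k ∸ d))
    shifted j j<ℓ = begin
      ev (toℕ (pt i j)) α                              ≡⟨ cong⇒agree i α (powQ (g i) k) c j j<ℓ ⟩
      ev (toℕ (pt i j)) (powQ (g i) k)                 ≡⟨ ev-powQ (toℕ (pt i j)) (g i) k ⟩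
      KF.pow (γ i j) k                                 ≡⟨ cong (KF.pow (γ i j)) (sym (ℕP.m∸n+n≡m d≤k)) ⟩
      KF.pow (γ i j) (k ∸ d + d)                       ≡⟨ KF.pow-+ (γ i j) (k ∸ d) d ⟩
      KF.pow (γ i j) (k ∸ d) KF.*ᶠ KF.pow (γ i j) d    ≡⟨ cong (KF.pow (γ i j) (k ∸ d) KF.*ᶠ_) (period j j<ℓ) ⟩
      KF.pow (γ i j) (k ∸ d) KF.*ᶠ KF.1#               ≡⟨ KF.*-identityʳ _ ⟩
      KF.pow (γ i j) (k ∸ d)                           ≡⟨ sym (ev-powQ (toℕ (pt i j)) (g i) (k ∸ d)) ⟩
      ev (toℕ (pt i j)) (powQ (g i) (k ∸ d))           ∎
      where open ≡-Reasoning

  log-bound : ∀ i α k → IsLog i α k → k < q ^ ℓ i ∸ 1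
  log-bound i α k isLog = below (order-bound i)
    where
    below : (Σ ℕ λ d → 0 < d × d < q ^ ℓ i × (∀ j → j < ℓ i → KF.pow (γ i j) d ≡ KF.1#)) → k < q ^ ℓ i ∸ 1
    below (d , d>0 , d<q^ℓ , period) = ℕP.<-≤-trans (log<period i α k d d>0 period isLog) (ℕP.∸-monoˡ-≤ 1 d<q^ℓ)

  log-agree : ∀ i α α′ k → IsLog i α k → IsLog i α′ k → AgreeOn i α α′
  log-agree i α α′ k (c , _) (c′ , _) j j<ℓ =
    trans (cong⇒agree i α (powQ (g i) k) c j j<ℓ) (sym (cong⇒agree i α′ (powQ (g i) k) c′ j j<ℓ))


-- For logarithms ks (ks i = log_{g_i} α) and an automorphism φ of
-- ∏_{i∈I} ℤ_{n_i}, the class S_i carries the base-q digits of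
--   N_i = b_i·n_i + φ_{i,I}(a mod n),   a_i = ks_i div D_i,  b_i = ks_i mod D_i,
-- (i ∈ I), resp. all digits q − 1 (i ∉ I).
module DigitMap (S : Setup) where
  open DiscreteLog S public
  open import Data.Nat using (_+_; _*_; _^_; _<_; _≤_; _∸_; z≤n; s≤s)
  open ClassNumbers S using (q≢0; D·ni≡q^ℓ-1; ni>0; D>0; q^ℓ≥2)
  open CyclotomicClasses S using (cover)
  open Arithmetic
  open Digits q

  reducedQuotients : Grp → Grp
  reducedQuotients ks i = mod' (div' (ks i) (D i)) (ni i)

  digitValue : (Grp → Grp) → Grp → Fin m → ℕ
  digitValue φ ks i = mod' (ks i) (D i) * ni i + φ (reducedQuotients ks) i

  HasDigits : Subset m → (Grp → Grp) → Grp → ℰ → Set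
  HasDigits I φ ks f = ∀ i j → j < ℓ i → toℕ (f (pt i j)) ≡ PhiVal I φ ks i j

  -- the two properties of the automorphism φ_I that are used
  PreservesValid : Subset m → (Grp → Grp) → Set
  PreservesValid I φ = ∀ x → Valid I x → Valid I (φ x)

  InjectiveOn : Subset m → (Grp → Grp) → Set
  InjectiveOn I φ = ∀ x y → Valid I x → Valid I y → EqI I (φ x) (φ y) → EqI I x y

  PhiVal-∈ : ∀ I φ ks i j → i ∈ I → PhiVal I φ ks i j ≡ dig (digitValue φ ks i) j
  PhiVal-∈ I φ ks i j i∈I = begin
      PhiVal I φ ks i j                                           ≡⟨ cong (λ b → if b then mod' (div' (digitValue φ ks i) (q ^ j)) q else q ∸ 1) (∈⇒lookup i∈I) ⟩
      mod' (div' (digitValue φ ks i) (q ^ j)) q                   ≡⟨ mod'≡ _ q ⟩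
      div' (digitValue φ ks i) (q ^ j) % q                        ≡⟨ cong (_% q) (div'≡ _ (q ^ j) ⦃ ℕP.m^n≢0 q j ⦄) ⟩
      dig (digitValue φ ks i) j                                   ∎
    where open ≡-Reasoning

  PhiVal-∉ : ∀ I φ ks i j → i ∉ I → PhiVal I φ ks i j ≡ q ∸ 1
  PhiVal-∉ I φ ks i j i∉I = cong (λ b → if b then mod' (div' (digitValue φ ks i) (q ^ j)) q else q ∸ 1) (∉⇒lookup i∉I)

  PhiVal<q : ∀ I φ ks i j → PhiVal I φ ks i j < q
  PhiVal<q I φ ks i j with i ∈? I
  ... | yes i∈I = subst (_< q) (sym (PhiVal-∈ I φ ks i j i∈I)) (dig< _ j)
  ... | no  i∉I = subst (_< q) (sym (PhiVal-∉ I φ ks i j i∉I)) (pred<self (ℕ.>-nonZero⁻¹ q))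

  reducedQuotients-valid : ∀ I ks → Valid I (reducedQuotients ks)
  reducedQuotients-valid I ks i _ = subst (_< ni i) (sym (mod'≡ _ (ni i) ⦃ ℕ.>-nonZero (ni>0 i) ⦄))
                                          (m%n<n _ (ni i) ⦃ ℕ.>-nonZero (ni>0 i) ⦄)
    where open import Data.Nat.DivMod using (m%n<n)

  -- N_i < D_i n_i = q^ℓ_i − 1, so N_i has at most ℓ_i digits and they are not all q − 1
  digitValue< : ∀ I φ ks i → PreservesValid I φ → i ∈ I → digitValue φ ks i < q ^ ℓ i ∸ 1
  digitValue< I φ ks i pres i∈I =
    subst (digitValue φ ks i <_) (D·ni≡q^ℓ-1 i)
          (divmod-bound _ (D i) _ (ni i) b<D (pres (reducedQuotients ks) (reducedQuotients-valid I ks) i i∈I))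
    where
    open import Data.Nat.DivMod using (m%n<n)
    b<D : mod' (ks i) (D i) < D i
    b<D = subst (_< D i) (sym (mod'≡ (ks i) (D i) ⦃ ℕ.>-nonZero (D>0 i) ⦄)) (m%n<n (ks i) (D i) ⦃ ℕ.>-nonZero (D>0 i) ⦄)

  q^ℓ-1<q^ℓ : ∀ i → q ^ ℓ i ∸ 1 < q ^ ℓ i
  q^ℓ-1<q^ℓ i = pred<self (ℕP.≤-trans (s≤s z≤n) (q^ℓ≥2 i))

  hasDigits⇒InE : ∀ I φ ks f → PreservesValid I φ → HasDigits I φ ks f → InE I f
  hasDigits⇒InE I φ ks f pres digits i = saturated⇒∉ , ∉⇒saturated
    where
    ∉⇒saturated : i ∉ I → ∀ z → InS i z → toℕ (f z) ≡ q ∸ 1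
    ∉⇒saturated i∉I z (j , j<ℓ , refl) = trans (digits i j j<ℓ) (PhiVal-∉ I φ ks i j i∉I)
    saturated⇒∉ : (∀ z → InS i z → toℕ (f z) ≡ q ∸ 1) → i ∉ I
    saturated⇒∉ saturated i∈I = ℕP.<-irrefl allMax (ℕP.≤-<-trans (digitValue< I φ ks i pres i∈I) (q^ℓ-1<q^ℓ i))
      where
      N< : digitValue φ ks i < q ^ ℓ i
      N< = ℕP.<-trans (digitValue< I φ ks i pres i∈I) (q^ℓ-1<q^ℓ i)
      allMax : suc (digitValue φ ks i) ≡ q ^ ℓ i
      allMax = dig-all-max (ℓ i) _ N< (λ j j<ℓ →
        trans (sym (PhiVal-∈ I φ ks i j i∈I)) (trans (sym (digits i j j<ℓ)) (saturated (pt i j) (j , j<ℓ , refl))))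

  digits⇒digitValue : ∀ I φ (ks ks′ : Grp) f f′ → PreservesValid I φ → HasDigits I φ ks f → HasDigits I φ ks′ f′ →
                      (∀ z → f z ≡ f′ z) → ∀ i → i ∈ I → digitValue φ ks i ≡ digitValue φ ks′ i
  digits⇒digitValue I φ ks ks′ f f′ pres digits digits′ f≗f′ i i∈I =
    dig-unique (ℓ i) _ _ (N< ks) (N< ks′) (λ j j<ℓ → begin
      dig (digitValue φ ks i) j    ≡⟨ sym (PhiVal-∈ I φ ks i j i∈I) ⟩
      PhiVal I φ ks i j            ≡⟨ sym (digits i j j<ℓ) ⟩
      toℕ (f (pt i j))             ≡⟨ cong toℕ (f≗f′ (pt i j)) ⟩
      toℕ (f′ (pt i j))            ≡⟨ digits′ i j j<ℓ ⟩
      PhiVal I φ ks′ i j           ≡⟨ PhiVal-∈ I φ ks′ i j i∈I ⟩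
      dig (digitValue φ ks′ i) j   ∎)
    where
    open ≡-Reasoning
    N< : ∀ ks → digitValue φ ks i < q ^ ℓ i
    N< ks = ℕP.<-trans (digitValue< I φ ks i pres i∈I) (q^ℓ-1<q^ℓ i)

  -- a logarithm is below D_i n_i, so reducing its quotient modulo n_i loses nothing
  log-decomposition : ∀ i α (ks : Grp) → IsLog i α (ks i) → ks i ≡ mod' (ks i) (D i) + reducedQuotients ks i * D i
  log-decomposition i α ks isLog = begin
      ks i                                    ≡⟨ m≡m%n+[m/n]*n (ks i) (D i) ⟩
      ks i % D i + ks i / D i * D i           ≡⟨ cong₂ (λ b a → b + a * D i) (sym (mod'≡ (ks i) (D i))) (sym a≡) ⟩
      mod' (ks i) (D i) + reducedQuotients ks i * D i ∎
    where
    open ≡-Reasoning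
    open import Data.Nat.DivMod using (m≡m%n+[m/n]*n; m<n*o⇒m/o<n; m<n⇒m%n≡m)
    instance _ = ℕ.>-nonZero (D>0 i)
             _ = ℕ.>-nonZero (ni>0 i)
    a<ni : ks i / D i < ni i
    a<ni = m<n*o⇒m/o<n (subst (ks i <_) (trans (sym (D·ni≡q^ℓ-1 i)) (ℕP.*-comm (D i) (ni i))) (log-bound i α (ks i) isLog))
    a≡ : reducedQuotients ks i ≡ ks i / D i
    a≡ = begin
      mod' (div' (ks i) (D i)) (ni i)  ≡⟨ cong (λ a → mod' a (ni i)) (div'≡ (ks i) (D i)) ⟩
      mod' (ks i / D i) (ni i)         ≡⟨ mod'≡ _ (ni i) ⟩
      (ks i / D i) % ni i              ≡⟨ m<n⇒m%n≡m a<ni ⟩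
      ks i / D i                       ∎

  -- from N_i (i ∈ I) recover b_i and, by injectivity of φ, a_i: the logarithms agree on I
  digitValue⇒logs : ∀ I φ α α′ (ks ks′ : Grp) → PreservesValid I φ → InjectiveOn I φ →
                    (∀ i → i ∈ I → IsLog i α (ks i)) → (∀ i → i ∈ I → IsLog i α′ (ks′ i)) →
                    (∀ i → i ∈ I → digitValue φ ks i ≡ digitValue φ ks′ i) → ∀ i → i ∈ I → ks i ≡ ks′ i
  digitValue⇒logs I φ α α′ ks ks′ pres inj logs logs′ sameN i i∈I = begin
      ks i                                               ≡⟨ log-decomposition i α ks (logs i i∈I) ⟩
      mod' (ks i) (D i) + reducedQuotients ks i * D i     ≡⟨ cong₂ (λ b a → b + a * D i) (proj₁ (parts i i∈I)) (sameA i i∈I) ⟩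
      mod' (ks′ i) (D i) + reducedQuotients ks′ i * D i   ≡⟨ sym (log-decomposition i α′ ks′ (logs′ i i∈I)) ⟩
      ks′ i                                              ∎
    where
    open ≡-Reasoning
    valid : Valid I (reducedQuotients ks)
    valid = reducedQuotients-valid I ks
    valid′ : Valid I (reducedQuotients ks′)
    valid′ = reducedQuotients-valid I ks′
    parts : ∀ i → i ∈ I → mod' (ks i) (D i) ≡ mod' (ks′ i) (D i) × φ (reducedQuotients ks) i ≡ φ (reducedQuotients ks′) i
    parts i i∈I = divmod-unique _ _ _ _ (ni i) (pres _ valid i i∈I) (pres _ valid′ i i∈I) (sameN i i∈I)
    sameA : EqI I (reducedQuotients ks) (reducedQuotients ks′)
    sameA = inj _ _ valid valid′ (λ i i∈I → proj₂ (parts i i∈I))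

  agree-everywhere : ∀ α α′ → (∀ i → AgreeOn i α α′) → α ≈Q α′
  agree-everywhere α α′ agree = ev-ext α α′ (λ w → onPoint w (cover w))
    where
    onPoint : ∀ w → (Σ (Fin m) λ i → Σ ℕ λ j → j < ℓ i × w ≡ pt i j) → ev (toℕ w) α ≡ ev (toℕ w) α′
    onPoint w (i , j , j<ℓ , refl) = agree i j j<ℓ

  logs-determine : ∀ I α α′ (ks : Grp) → InQ I α → InQ I α′ →
                   (∀ i → i ∈ I → IsLog i α (ks i)) → (∀ i → i ∈ I → IsLog i α′ (ks i)) → α ≈Q α′
  logs-determine I α α′ ks inQ inQ′ logs logs′ = agree-everywhere α α′ agreeOn
    where
    agreeOn : ∀ i → AgreeOn i α α′
    agreeOn i with i ∈? I
    ... | yes i∈I = log-agree i α α′ (ks i) (logs i i∈I) (logs′ i i∈I)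
    ... | no  i∉I = λ j j<ℓ → trans (div⇒ev i α (proj₂ (inQ i) i∉I) j j<ℓ) (sym (div⇒ev i α′ (proj₂ (inQ′ i) i∉I) j j<ℓ))

  digits-injective : ∀ I φ → PreservesValid I φ → InjectiveOn I φ → ∀ α α′ (ks ks′ : Grp) f f′ → InQ I α → InQ I α′ →
                     (∀ i → i ∈ I → IsLog i α (ks i)) → (∀ i → i ∈ I → IsLog i α′ (ks′ i)) →
                     HasDigits I φ ks f → HasDigits I φ ks′ f′ → (∀ z → f z ≡ f′ z) → α ≈Q α′
  digits-injective I φ pres inj α α′ ks ks′ f f′ inQ inQ′ logs logs′ digits digits′ f≗f′ =
    logs-determine I α α′ ks inQ inQ′ logs (λ i i∈I → subst (IsLog i α′) (sym (sameLogs i i∈I)) (logs′ i i∈I))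
    where
    sameLogs : ∀ i → i ∈ I → ks i ≡ ks′ i
    sameLogs = digitValue⇒logs I φ α α′ ks ks′ pres inj logs logs′
                 (digits⇒digitValue I φ ks ks′ f f′ pres digits digits′ f≗f′)

  PhiVal-cong : ∀ I φ (ks ks′ : Grp) → (∀ x y → Valid I x → Valid I y → EqI I x y → EqI I (φ x) (φ y)) →
                (∀ i → i ∈ I → ks i ≡ ks′ i) → ∀ i j → PhiVal I φ ks i j ≡ PhiVal I φ ks′ i j
  PhiVal-cong I φ ks ks′ φ-cong same i j with i ∈? I
  ... | no  i∉I = trans (PhiVal-∉ I φ ks i j i∉I) (sym (PhiVal-∉ I φ ks′ i j i∉I))
  ... | yes i∈I = begin
      PhiVal I φ ks i j            ≡⟨ PhiVal-∈ I φ ks i j i∈I ⟩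
      dig (digitValue φ ks i) j    ≡⟨ cong (λ N → dig N j) sameN ⟩
      dig (digitValue φ ks′ i) j   ≡⟨ sym (PhiVal-∈ I φ ks′ i j i∈I) ⟩
      PhiVal I φ ks′ i j           ∎
    where
    open ≡-Reasoning
    sameA : EqI I (reducedQuotients ks) (reducedQuotients ks′)
    sameA i′ i′∈I = cong (λ k → mod' (div' k (D i′)) (ni i′)) (same i′ i′∈I)
    sameN : digitValue φ ks i ≡ digitValue φ ks′ i
    sameN = cong₂ (λ b a → b * ni i + a) (cong (λ k → mod' k (D i)) (same i i∈I))
                  (φ-cong _ _ (reducedQuotients-valid I ks) (reducedQuotients-valid I ks′) sameA i i∈I)


-- To compare images of elements with
-- different supports, the digit map is extended to all of 𝒬: α ∈ 𝒬_J is sent through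
-- φ_I if J = I and through the identity otherwise.
module Bijection (S : Setup) (I : Subset (SetupDefs.m S)) (φI : SetupDefs.Grp S → SetupDefs.Grp S)
                 (good : SetupDefs.GoodAut S I φI) where
  open DigitMap S public
  open import Data.Nat using (_^_; _<_)
  open import Data.Bool.Properties using () renaming (_≟_ to _≟B_)
  open ClassNumbers S using (q≢0)
  open CyclotomicClasses S using (cover; unique)

  φI-preserves : PreservesValid I φI
  φI-preserves = proj₁ (proj₁ good)

  φI-cong : ∀ x y → Valid I x → Valid I y → EqI I x y → EqI I (φI x) (φI y)
  φI-cong = proj₁ (proj₂ (proj₁ good))

  φI-injectiveOn : InjectiveOn I φI
  φI-injectiveOn = proj₁ (proj₂ (proj₂ (proj₂ (proj₁ good))))

  φ : Subset m → Grp → Grp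
  φ J with VecP.≡-dec _≟B_ J I
  ... | yes _ = φI
  ... | no  _ = id

  φ-valid-injective : ∀ J → PreservesValid J (φ J) × InjectiveOn J (φ J)
  φ-valid-injective J with VecP.≡-dec _≟B_ J I
  ... | yes refl = φI-preserves , φI-injectiveOn
  ... | no  _    = (λ _ valid → valid) , (λ _ _ _ _ same → same)

  φ-I : φ I ≡ φI
  φ-I with VecP.≡-dec _≟B_ I I
  ... | yes _  = refl
  ... | no I≢I = ⊥-elim (I≢I refl)

  support : 𝒬 → Subset m
  support α = Data.Vec.tabulate (λ i → not ⌊ div? i α ⌋)

  lookup-support : ∀ α i → Data.Vec.lookup (support α) i ≡ not ⌊ div? i α ⌋
  lookup-support α i = VecP.lookup∘tabulate _ i

  support-InQ : ∀ α → InQ (support α) α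
  support-InQ α i = classify (div? i α) (lookup-support α i)
    where
    classify : (d : Dec (Pq i ∣Q α)) → Data.Vec.lookup (support α) i ≡ not ⌊ d ⌋ →
               ((Pq i ∣Q α) → i ∉ support α) × (i ∉ support α → Pq i ∣Q α)
    classify (yes P∣α) e = (λ _ i∈ → contradiction (trans (sym (∈⇒lookup i∈)) e)) , (λ _ → P∣α)
      where contradiction : true ≡ false → _
            contradiction ()
    classify (no ¬P∣α) e = (λ P∣α _ → ¬P∣α P∣α) , (λ i∉ → ⊥-elim (i∉ (VecP.lookup⇒[]= i (support α) e)))

  InQ-unique : ∀ J J′ α → InQ J α → InQ J′ α → J ≡ J′
  InQ-unique J J′ α inQ inQ′ = subset-ext J J′ (λ i i∉J′ → proj₁ (inQ i) (proj₂ (inQ′ i) i∉J′))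
                                              (λ i i∉J → proj₁ (inQ′ i) (proj₂ (inQ i) i∉J))

  -- the logarithms of α (0 where P_i ∣ α)
  logs : 𝒬 → Grp
  logs α i = logOf (div? i α)
    where logOf : Dec (Pq i ∣Q α) → ℕ
          logOf (yes _)    = 0
          logOf (no ¬P∣α) = proj₁ (log-exists i α ¬P∣α)

  logs-isLog : ∀ α i → i ∈ support α → IsLog i α (logs α i)
  logs-isLog α i i∈ with div? i α | lookup-support α i
  ... | yes P∣α | e = ⊥-elim (proj₁ (support-InQ α i) P∣α i∈)
  ... | no ¬P∣α | _ = proj₂ (log-exists i α ¬P∣α)

  Φ : 𝒬 → ℰ
  Φ α z = Fin.fromℕ< (PhiVal<q (support α) (φ (support α)) (logs α) (proj₁ (cover z)) (proj₁ (proj₂ (cover z))))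

  position-unique : (F′ : Fin m → ℕ → ℕ) → ∀ i j i′ j′ → j < ℓ i → j′ < ℓ i′ → pt i j ≡ pt i′ j′ → F′ i′ j′ ≡ F′ i j
  position-unique F′ i j i′ j′ j< j′< e with unique i j i′ j′ j< j′< e
  ... | refl , j≡j′ = cong (F′ i) (sym j≡j′)

  Φ-digits : ∀ α → HasDigits (support α) (φ (support α)) (logs α) (Φ α)
  Φ-digits α i j j<ℓ = trans (FinP.toℕ-fromℕ< _)
    (position-unique (PhiVal (support α) (φ (support α)) (logs α)) i j _ _ j<ℓ
                     (proj₁ (proj₂ (proj₂ c))) (proj₂ (proj₂ (proj₂ c))))
    where c = cover (pt i j)

  Φ-InE : ∀ α → InE (support α) (Φ α)
  Φ-InE α = hasDigits⇒InE (support α) (φ (support α)) (logs α) (Φ α) (proj₁ (φ-valid-injective (support α))) (Φ-digits α)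

  InE-unique : ∀ J J′ f f′ → InE J f → InE J′ f′ → (∀ z → f z ≡ f′ z) → J ≡ J′
  InE-unique J J′ f f′ inE inE′ f≗f′ =
    subset-ext J J′ (λ i i∉J′ → proj₁ (inE i) (λ z z∈ → trans (cong toℕ (f≗f′ z)) (proj₂ (inE′ i) i∉J′ z z∈)))
                    (λ i i∉J → proj₁ (inE′ i) (λ z z∈ → trans (cong toℕ (sym (f≗f′ z))) (proj₂ (inE i) i∉J z z∈)))

  -- Φ is injective on all of 𝒬: equal images force equal supports, then apply digits-injective
  Φ-injective : ∀ α α′ → (∀ z → Φ α z ≡ Φ α′ z) → α ≈Q α′
  Φ-injective α α′ same =
    digits-injective Jα (φ Jα) (proj₁ (φ-valid-injective Jα)) (proj₂ (φ-valid-injective Jα))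
      α α′ (logs α) (logs α′) (Φ α) (Φ α′)
      (support-InQ α) (subst (λ J → InQ J α′) (sym J≡J′) (support-InQ α′))
      (logs-isLog α) (λ i i∈ → logs-isLog α′ i (subst (i ∈_) J≡J′ i∈))
      (Φ-digits α) (subst (λ J → HasDigits J (φ J) (logs α′) (Φ α′)) (sym J≡J′) (Φ-digits α′)) same
    where
    Jα = support α
    J≡J′ : support α ≡ support α′
    J≡J′ = InE-unique _ _ (Φ α) (Φ α′) (Φ-InE α) (Φ-InE α′) same

  -- counting: Φ is an injection between sets of size q^n, hence onto
  module _ where
    open Arithmetic.Digits q

    decode : Fin (q ^ n) → 𝒬
    decode c w = fromFin (Fin.fromℕ< (dig< (toℕ c) (toℕ w)))

    encode : ℰ → Fin (q ^ n)
    encode f = Fin.fromℕ< (enc< (λ w → toℕ (f w)) (λ w → FinP.toℕ<n (f w)))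

    encode-injective : ∀ f f′ → encode f ≡ encode f′ → ∀ w → f w ≡ f′ w
    encode-injective f f′ e w = FinP.toℕ-injective (begin
        toℕ (f w)                                 ≡⟨ sym (dig-enc (λ w → toℕ (f w)) (λ w → FinP.toℕ<n (f w)) w) ⟩
        dig (enc (λ w → toℕ (f w))) (toℕ w)       ≡⟨ cong (λ c → dig c (toℕ w)) sameCode ⟩
        dig (enc (λ w → toℕ (f′ w))) (toℕ w)      ≡⟨ dig-enc (λ w → toℕ (f′ w)) (λ w → FinP.toℕ<n (f′ w)) w ⟩
        toℕ (f′ w)                                ∎)
      where
      open ≡-Reasoning
      sameCode : enc (λ w → toℕ (f w)) ≡ enc (λ w → toℕ (f′ w))
      sameCode = trans (sym (FinP.toℕ-fromℕ< _)) (trans (cong toℕ e) (FinP.toℕ-fromℕ< _))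

    decode-injective : ∀ c c′ → decode c ≈Q decode c′ → c ≡ c′
    decode-injective c c′ same = FinP.toℕ-injective (dig-unique n (toℕ c) (toℕ c′) (FinP.toℕ<n c) (FinP.toℕ<n c′) sameDigit)
      where
      digitAt : ∀ w → dig (toℕ c) (toℕ w) ≡ dig (toℕ c′) (toℕ w)
      digitAt w = trans (sym (FinP.toℕ-fromℕ< _)) (trans (cong toℕ (fromFin-injective (same w))) (FinP.toℕ-fromℕ< _))
      sameDigit : ∀ j → j < n → dig (toℕ c) j ≡ dig (toℕ c′) j
      sameDigit j j<n = subst (λ t → dig (toℕ c) t ≡ dig (toℕ c′) t) (FinP.toℕ-fromℕ< j<n) (digitAt (Fin.fromℕ< j<n))

    Φ-surjective : ∀ f → Σ 𝒬 λ α → ∀ z → Φ α z ≡ f z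
    Φ-surjective f = fromPreimage (Finite.injective⇒surjective Ψ Ψ-injective (encode f))
      where
      Ψ : Fin (q ^ n) → Fin (q ^ n)
      Ψ = encode ∘ Φ ∘ decode
      Ψ-injective : ∀ c c′ → Ψ c ≡ Ψ c′ → c ≡ c′
      Ψ-injective c c′ e = decode-injective c c′ (Φ-injective _ _ (encode-injective _ _ e))
      fromPreimage : (Σ (Fin (q ^ n)) λ c → Ψ c ≡ encode f) → Σ 𝒬 λ α → ∀ z → Φ α z ≡ f z
      fromPreimage (c , Ψc≡) = decode c , encode-injective _ _ Ψc≡

  Φ-isPhi : ∀ α → InQ I α → IsPhi I φI α (Φ α)
  Φ-isPhi α inQ = logs α , (λ i i∈I → logs-isLog α i (subst (i ∈_) (sym support≡I) i∈I)) ,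
                  subst (λ φ′ → HasDigits I φ′ (logs α) (Φ α)) φ-I
                        (subst (λ J → HasDigits J (φ J) (logs α) (Φ α)) support≡I (Φ-digits α))
    where
    support≡I : support α ≡ I
    support≡I = InQ-unique _ _ α (support-InQ α) inQ

  IsPhi-transport : ∀ α f f′ → IsPhi I φI α f → (∀ z → f z ≡ f′ z) → IsPhi I φI α f′
  IsPhi-transport α f f′ (ks , isLog , digits) f≗f′ =
    ks , isLog , λ i j j<ℓ → trans (cong toℕ (sym (f≗f′ (pt i j)))) (digits i j j<ℓ)

  phi-total : ∀ α → InQ I α → Σ ℰ λ f → IsPhi I φI α f × InE I f
  phi-total α inQ = Φ α , Φ-isPhi α inQ , subst (λ J → InE J (Φ α)) (InQ-unique _ _ α (support-InQ α) inQ) (Φ-InE α)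

  -- φ_I is well defined, because logarithms are unique
  phi-functional : ∀ α f f′ → InQ I α → IsPhi I φI α f → IsPhi I φI α f′ → ∀ z → f z ≡ f′ z
  phi-functional α f f′ _ (ks , isLog , digits) (ks′ , isLog′ , digits′) z with cover z
  ... | i , j , j<ℓ , refl = FinP.toℕ-injective (begin
      toℕ (f (pt i j))     ≡⟨ digits i j j<ℓ ⟩
      PhiVal I φI ks i j   ≡⟨ PhiVal-cong I φI ks ks′ φI-cong (λ i i∈I → log-unique i α _ _ (isLog i i∈I) (isLog′ i i∈I)) i j ⟩
      PhiVal I φI ks′ i j  ≡⟨ sym (digits′ i j j<ℓ) ⟩
      toℕ (f′ (pt i j))    ∎)
    where open ≡-Reasoning

  phi-injective : ∀ α α′ f → InQ I α → InQ I α′ → IsPhi I φI α f → IsPhi I φI α′ f → α ≈Q α′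
  phi-injective α α′ f inQ inQ′ (ks , isLog , digits) (ks′ , isLog′ , digits′) =
    digits-injective I φI φI-preserves φI-injectiveOn α α′ ks ks′ f f inQ inQ′ isLog isLog′ digits digits′ (λ _ → refl)

  phi-surjective : ∀ f → InE I f → Σ 𝒬 λ α → InQ I α × IsPhi I φI α f
  phi-surjective f inE = fromPreimage (Φ-surjective f)
    where
    fromPreimage : (Σ 𝒬 λ α → ∀ z → Φ α z ≡ f z) → Σ 𝒬 λ α → InQ I α × IsPhi I φI α f
    fromPreimage (α , Φα≗f) = α , inQ , IsPhi-transport α (Φ α) f (Φ-isPhi α inQ) Φα≗f
      where
      inQ : InQ I α
      inQ = subst (λ J → InQ J α) (InE-unique _ _ (Φ α) f (Φ-InE α) inE Φα≗f) (support-InQ α)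


lemma4p10 : (S : Setup) (I : Subset (SetupDefs.m S))
            (φI : SetupDefs.Grp S → SetupDefs.Grp S) →
            SetupDefs.GoodAut S I φI →
            SetupDefs.PhiBijective S I φI
lemma4p10 S I φI good = phi-total , phi-functional , phi-injective , phi-surjective
  where open Bijection S I φI good
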